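{- Let $n\ge1$, $d\ge0$. Every sorted recurrent configuration on $S_{n,d}$ is toppling-and-permuting equivalent to exactly $n+1$ of the $\binom{2n+d}{n}\binom{n+d}{n}$ sorted quasi-stable non-negative configurations on $S_{n,d}$ (including itself, but no other sorted recurrent configuration).
   Context: The complete split graph $S_{n,d}$ has a sink $s$, clique vertices $K=\{v_1,\ldots,v_n\}$ (indexed $0,\ldots,n-1$) and independent vertices $I=\{w_1,\ldots,w_d\}$ (indexed $0,\ldots,d-1$); any two distinct vertices among $s,v_1,\ldots,v_n$ are adjacent, each $w_j$ is adjacent to each of $s,v_1,\ldots,v_n$, no two $w_j$'s are adjacent. So $\deg(v)=n+d$ for $v\in K\cup\{s\}$ and $\deg(w)=n+1$ for $w\in I$. Here a configuration is any $u=(u^{[K]};u^{[I]})\in\mathbb{Z}^n\times\mathbb{Z}^d$ (entries may be negative), the sink carrying $u_s=-(\sum_k u^{[K]}_k+\sum_i u^{[I]}_i)$. For any vertex $v$ (including $s$), $\Delta^{(v)}$ is the toppling vector: adding it removes $\deg(v)$ grains from $v$ and adds one grain to each neighbour of $v$. A permutation $\sigma^{[C]}$ of a component $C\in\{K,I\}$ acts by $(\sigma^{[C]}.u^{[C]})_c=u^{[C]}_{\sigma^{[C]}(c)}$. Two configurations $u,u'$ are toppling-and-permuting equivalent if $u'=(\sigma^{[K]},\sigma^{[I]}).u+\sum_{v}a_v\Delta^{(v)}$ for some permutations $\sigma^{[K]}$ of $K$, $\sigma^{[I]}$ of $I$, and integers $(a_v)$ indexed by all vertices including $s$. A configuration is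 sorted if $u^{[K]}$ and $u^{[I]}$ are weakly decreasing sequences, non-negative if all its (non-sink) entries are $\ge0$, and quasi-stable if $\max_k u^{[K]}_k\le n+d$ and $\max_i u^{[I]}_i\le n$. A non-negative configuration is stable if each non-sink vertex has fewer grains than its degree; a stable configuration $c$ is recurrent iff there is an ordering $s=u_0,\ldots,u_{n+d}$ of all vertices such that from $c$, toppling $u_0,\ldots,u_{i-1}$ in turn makes $u_i$ unstable (number of grains $\ge$ degree) for each $i\ge1$. -}

module Defs where

open import Data.Nat as ℕ using (ℕ; zero; suc; _<ᵇ_)
open import Data.Integer as ℤ using (ℤ; +_; -_; _+_; _*_; _≤_; _<_)
open import Data.Fin as Fin using (Fin; toℕ)
open import Data.Fin.Permutation using (Permutation′; _⟨$⟩ʳ_)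
open import Data.Vec as Vec using (Vec; lookup; tabulate; zipWith; replicate)
open import Data.Sum using (_⊎_; inj₁; inj₂)
open import Data.Product using (_×_; _,_; Σ; ∃; ∃-syntax; proj₁; proj₂)
open import Data.Bool using (if_then_else_)
open import Relation.Binary.PropositionalEquality using (_≡_; _≢_)
open import Function.Bundles using (_⤖_; Bijection)

data Vertex (n d : ℕ) : Set where
  sink : Vertex n d
  kv   : Fin n → Vertex n d
  iv   : Fin d → Vertex n d

nonSink : ∀ {n d} → Fin n ⊎ Fin d → Vertex n d
nonSink (inj₁ k) = kv k
nonSink (inj₂ i) = iv i

deg : ∀ {n d} → Vertex n d → ℕ
deg {n} {d} sink   = n ℕ.+ d
deg {n} {d} (kv _) = n ℕ.+ d
deg {n} {d} (iv _) = suc n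

-- Configuration u = (u^[K] ; u^[I]); the sink value is derived.
Config : ℕ → ℕ → Set
Config n d = Vec ℤ n × Vec ℤ d

sumVec : ∀ {m} → Vec ℤ m → ℤ
sumVec = Vec.foldr _ _+_ (+ 0)

grains : ∀ {n d} → Config n d → Vertex n d → ℤ
grains (uK , uI) sink   = - (sumVec uK + sumVec uI)
grains (uK , uI) (kv k) = lookup uK k
grains (uK , uI) (iv i) = lookup uI i

zeroC : ∀ {n d} → Config n d
zeroC = replicate _ (+ 0) , replicate _ (+ 0)

_⊕_ : ∀ {n d} → Config n d → Config n d → Config n d
(aK , aI) ⊕ (bK , bI) = zipWith _+_ aK bK , zipWith _+_ aI bI

_·_ : ∀ {n d} → ℤ → Config n d → Config n d
z · (aK , aI) = Vec.map (z *_) aK , Vec.map (z *_) aI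

Δ : ∀ {n d} → Vertex n d → Config n d
Δ {n} {d} sink   = replicate _ (+ 1) , replicate _ (+ 1)
Δ {n} {d} (kv k) =
  tabulate (λ k′ → if toℕ k′ ℕ.≡ᵇ toℕ k then - (+ (n ℕ.+ d)) else + 1) ,
  replicate _ (+ 1)
Δ {n} {d} (iv i) =
  replicate _ (+ 1) ,
  tabulate (λ i′ → if toℕ i′ ℕ.≡ᵇ toℕ i then - (+ suc n) else + 0)

ΣC : ∀ {n d} m → (Fin m → Config n d) → Config n d
ΣC zero    f = zeroC
ΣC (suc m) f = f Fin.zero ⊕ ΣC m (λ j → f (Fin.suc j))

toppleComb : ∀ {n d} → (Vertex n d → ℤ) → Config n d
toppleComb {n} {d} a =
  (a sink · Δ sink) ⊕ (ΣC n (λ k → a (kv k) · Δ (kv k)) ⊕ ΣC d (λ i → a (iv i) · Δ (iv i)))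

permVec : ∀ {m} → Permutation′ m → Vec ℤ m → Vec ℤ m
permVec σ u = tabulate (λ c → lookup u (σ ⟨$⟩ʳ c))

TPEquiv : ∀ {n d} → Config n d → Config n d → Set
TPEquiv {n} {d} u u′ =
  ∃[ σK ] ∃[ σI ] ∃[ a ]
    (u′ ≡ ((permVec {n} σK (proj₁ u) , permVec {d} σI (proj₂ u)) ⊕ toppleComb a))

WeaklyDecreasing : ∀ {m} → Vec ℤ m → Set
WeaklyDecreasing {m} u = ∀ (i j : Fin m) → toℕ i ℕ.≤ toℕ j → lookup u j ≤ lookup u i

Sorted : ∀ {n d} → Config n d → Set
Sorted (uK , uI) = WeaklyDecreasing uK × WeaklyDecreasing uI

NonNegative : ∀ {n d} → Config n d → Set
NonNegative {n} {d} (uK , uI) =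
  (∀ k → + 0 ≤ lookup uK k) × (∀ i → + 0 ≤ lookup uI i)

QuasiStable : ∀ {n d} → Config n d → Set
QuasiStable {n} {d} (uK , uI) =
  (∀ k → lookup uK k ≤ + (n ℕ.+ d)) × (∀ i → lookup uI i ≤ + n)

Stable : ∀ {n d} → Config n d → Set
Stable {n} {d} u =
  NonNegative u × (∀ (x : Fin n ⊎ Fin d) → grains u (nonSink x) < + deg (nonSink x))

-- Recurrence via an ordering s = u_0, u_1, …, u_{n+d} of all vertices:
-- ord j is u_{j+1}; after toppling s, u_1, …, u_i the vertex u_{i+1} is unstable.
Recurrent : ∀ {n d} → Config n d → Set
Recurrent {n} {d} c =
  Stable c ×
  Σ (Fin (n ℕ.+ d) ⤖ (Fin n ⊎ Fin d)) λ ord → ((i : Fin (n ℕ.+ d)) →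
    + deg (nonSink (Bijection.to ord i)) ≤
      grains (c ⊕ (Δ sink ⊕ ΣC (n ℕ.+ d)
                (λ j → if toℕ j <ᵇ toℕ i then Δ (nonSink (Bijection.to ord j)) else zeroC)))
             (nonSink (Bijection.to ord i)))

SQN : ∀ {n d} → Config n d → Set
SQN u = Sorted u × QuasiStable u × NonNegative u

-- A sorted quasi-stable non-negative configuration is a pair of weakly decreasing sequences
-- with entries in [0, n+d] and [0, n]; these are counted by binomial coefficients.
-- A toppling-and-permuting equivalence c ~ u has a normal form with a level R (the topplings
-- of the sink plus those of the clique): the entries of u on K and I are those of c, permuted,
-- shifted by R + Σβ − (n+d+1)α_k and R − (n+1)β_i.  Shifting all topplings by q changes R by
-- q(n+1), and for each residue t of R modulo n+1 reducing the entries and sorting gives exactly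
-- one sorted quasi-stable non-negative configuration, so the class contains n+1 of them.
-- Between two recurrent configurations, if some vertex toppled more often than the sink, the
-- vertices toppling most often would form a forbidden subconfiguration, which recurrent
-- configurations do not have (Dhar's burning argument).  So all vertices topple equally often,
-- R is a multiple of n+1, and c is the only recurrent configuration among the n+1.
module Submission where

module IntegerSums where

  open import Data.Nat as ℕ using (ℕ; zero; suc)
  open import Data.Integer using (ℤ; +_; -_; _+_; _*_; _-_; _≤_; 0ℤ; 1ℤ)
  import Data.Integer.Properties as ℤP
  open import Data.Integer.Tactic.RingSolver using (solve-∀)
  open import Data.Fin using (Fin; zero; suc; toℕ; splitAt; _↑ˡ_; _↑ʳ_)
  import Data.Fin.Properties as FinP
  open import Data.Fin.Permutation using (Permutation′; _⟨$⟩ʳ_)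
  open import Data.Sum using (_⊎_; inj₁; inj₂)
  open import Data.Bool using (Bool; true; false; if_then_else_)
  open import Function using (_∘_)
  open import Function.Bundles using (_⤖_; Bijection)
  open import Function.Properties.Bijection using (⤖⇒↔)
  open import Function.Construct.Composition using (_↔-∘_)
  open import Function.Construct.Symmetry using (↔-sym)
  open import Relation.Binary.PropositionalEquality
  open import Algebra.Properties.Semiring.Sum ℤP.+-*-semiring public
    using (sum; sum-cong-≗; ∑-distrib-+; sum-permute; *-distribʳ-sum)

  private variable m : ℕ

  ⟦_⟧ : Bool → ℤ
  ⟦ b ⟧ = if b then 1ℤ else 0ℤ

  sum-mono-≤ : {f g : Fin m → ℤ} → (∀ j → f j ≤ g j) → sum f ≤ sum g
  sum-mono-≤ {zero}  f≤g = ℤP.≤-refl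
  sum-mono-≤ {suc m} f≤g = ℤP.+-mono-≤ (f≤g zero) (sum-mono-≤ (f≤g ∘ suc))

  sum-neg : (f : Fin m → ℤ) → sum (λ j → - f j) ≡ - sum f
  sum-neg {zero}  f = refl
  sum-neg {suc m} f = trans (cong (_+_ (- f zero)) (sum-neg (f ∘ suc))) (sym (ℤP.neg-distrib-+ (f zero) _))

  sum-const : ∀ m (x : ℤ) → sum {m} (λ _ → x) ≡ + m * x
  sum-const zero    x = sym (ℤP.*-zeroˡ x)
  sum-const (suc m) x = trans (cong (_+_ x) (sum-const m x)) (x+mx≡[1+m]x x (+ m))
    where
    x+mx≡[1+m]x : ∀ x m → x + m * x ≡ (1ℤ + m) * x
    x+mx≡[1+m]x = solve-∀

  sum-zero : ∀ m → sum {m} (λ _ → 0ℤ) ≡ 0ℤ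
  sum-zero m = trans (sum-const m 0ℤ) (ℤP.*-zeroʳ (+ m))

  sum-*-if : (k : Fin m) (x y : ℤ) (f : Fin m → ℤ) →
             sum (λ j → f j * (if toℕ k ℕ.≡ᵇ toℕ j then x else y)) ≡ sum f * y + (x - y) * f k
  sum-*-if {suc m} zero x y f =
    trans (cong (_+_ (f zero * x)) (sym (*-distribʳ-sum y (f ∘ suc)))) (rearrange (f zero) x y (sum (f ∘ suc)))
    where
    rearrange : ∀ a x y s → a * x + s * y ≡ (a + s) * y + (x - y) * a
    rearrange = solve-∀
  sum-*-if {suc m} (suc k) x y f =
    trans (cong (_+_ (f zero * y)) (sum-*-if k x y (f ∘ suc))) (rearrange (f zero) y (sum (f ∘ suc)) ((x - y) * f (suc k)))
    where
    rearrange : ∀ a y s t → a * y + (s * y + t) ≡ (a + s) * y + t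
    rearrange = solve-∀

  sum-minus-const : ∀ {m} (f : Fin m → ℤ) x → sum (λ j → f j - x) ≡ sum f - + m * x
  sum-minus-const {m} f x =
    trans (∑-distrib-+ f (λ _ → - x)) (cong (_+_ (sum f)) (trans (sum-const m (- x)) (sym (ℤP.neg-distribʳ-* (+ m) x))))

  sum-if-0-1 : ∀ {m} (P : Fin m → Bool) → sum (λ j → if P j then 0ℤ else 1ℤ) ≡ + m - sum (λ j → ⟦ P j ⟧)
  sum-if-0-1 {m} P = begin
    sum (λ j → if P j then 0ℤ else 1ℤ)    ≡⟨ sum-cong-≗ (λ j → 1-⟦⟧ (P j)) ⟩
    sum (λ j → 1ℤ + - ⟦ P j ⟧)            ≡⟨ ∑-distrib-+ (λ _ → 1ℤ) (λ j → - ⟦ P j ⟧) ⟩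
    sum {m} (λ _ → 1ℤ) + sum (λ j → - ⟦ P j ⟧)
      ≡⟨ cong₂ _+_ (trans (sum-const m 1ℤ) (ℤP.*-identityʳ (+ m))) (sum-neg (λ j → ⟦ P j ⟧)) ⟩
    + m - sum (λ j → ⟦ P j ⟧)              ∎
    where
    open ≡-Reasoning
    1-⟦⟧ : ∀ b → (if b then 0ℤ else 1ℤ) ≡ 1ℤ + - ⟦ b ⟧
    1-⟦⟧ true  = refl
    1-⟦⟧ false = refl

  sum-splitAt : ∀ m {k} (g : Fin (m ℕ.+ k) → ℤ) → sum g ≡ sum (g ∘ (_↑ˡ k)) + sum (g ∘ (m ↑ʳ_))
  sum-splitAt zero    g = sym (ℤP.+-identityˡ (sum g))
  sum-splitAt (suc m) g = trans (cong (_+_ (g zero)) (sum-splitAt m (g ∘ suc))) (sym (ℤP.+-assoc (g zero) _ _))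

  sum-bijection : ∀ {n d} (f : Fin (n ℕ.+ d) ⤖ (Fin n ⊎ Fin d)) (h : Fin n ⊎ Fin d → ℤ) →
                  sum (h ∘ Bijection.to f) ≡ sum (h ∘ inj₁) + sum (h ∘ inj₂)
  sum-bijection {n} {d} f h = begin
    sum (h ∘ Bijection.to f)          ≡⟨ sum-cong-≗ (λ j → cong h (FinP.splitAt-join n d (Bijection.to f j))) ⟨
    sum (g ∘ (π ⟨$⟩ʳ_))               ≡⟨ sum-permute g π ⟨
    sum g                             ≡⟨ sum-splitAt n g ⟩
    sum (g ∘ (_↑ˡ d)) + sum (g ∘ (n ↑ʳ_))
      ≡⟨ cong₂ _+_ (sum-cong-≗ (λ k → cong h (FinP.splitAt-↑ˡ n k d)))
                   (sum-cong-≗ (λ i → cong h (FinP.splitAt-↑ʳ n d i))) ⟩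
    sum (h ∘ inj₁) + sum (h ∘ inj₂)   ∎
    where
    open ≡-Reasoning
    g : Fin (n ℕ.+ d) → ℤ
    g = h ∘ splitAt n
    π : Permutation′ (n ℕ.+ d)
    π = ↔-sym FinP.+↔⊎ ↔-∘ ⤖⇒↔ f

module SortedVectors where

  open import Defs using (WeaklyDecreasing; permVec)
  open import Data.Nat using (ℕ; zero; suc; z≤n; s≤s)
  open import Data.Integer using (ℤ; _≤_)
  import Data.Integer.Properties as ℤP
  open import Data.Fin using (Fin; zero; suc)
  import Data.Fin.Properties as FinP
  open import Data.Fin.Permutation as Perm using (Permutation′; _⟨$⟩ʳ_; _⟨$⟩ˡ_; _∘ₚ_; lift₀; transpose)
  open import Data.Vec as Vec using (Vec; _∷_; lookup)
  import Data.Vec.Properties as VecP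
  open import Data.Product using (_×_; _,_; proj₁; proj₂; ∃-syntax)
  open import Function using (_∘_; Injective)
  open import Relation.Nullary using (yes; no)
  open import Relation.Binary.PropositionalEquality

  private variable m : ℕ

  lookup-ext : {u v : Vec ℤ m} → (∀ i → lookup u i ≡ lookup v i) → u ≡ v
  lookup-ext {u = u} {v} u≗v =
    trans (sym (VecP.tabulate∘lookup u)) (trans (VecP.tabulate-cong u≗v) (VecP.tabulate∘lookup v))

  lookup-permVec : (σ : Permutation′ m) (v : Vec ℤ m) (i : Fin m) → lookup (permVec σ v) i ≡ lookup v (σ ⟨$⟩ʳ i)
  lookup-permVec σ v i = VecP.lookup∘tabulate _ i

  WD-∷⁻ : ∀ x (xs : Vec ℤ m) → WeaklyDecreasing (x ∷ xs) → (∀ k → lookup xs k ≤ x) × WeaklyDecreasing xs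
  WD-∷⁻ x xs wd = (λ k → wd zero (suc k) z≤n) , (λ i j i≤j → wd (suc i) (suc j) (s≤s i≤j))

  WD-∷⁺ : ∀ x (xs : Vec ℤ m) → (∀ k → lookup xs k ≤ x) → WeaklyDecreasing xs → WeaklyDecreasing (x ∷ xs)
  WD-∷⁺ x xs xs≤x wd zero    zero    _         = ℤP.≤-refl
  WD-∷⁺ x xs xs≤x wd zero    (suc j) _         = xs≤x j
  WD-∷⁺ x xs xs≤x wd (suc i) (suc j) (s≤s i≤j) = wd i j i≤j

  WD-resp : {u v : Vec ℤ m} → (∀ k → lookup u k ≡ lookup v k) → WeaklyDecreasing u → WeaklyDecreasing v
  WD-resp u≗v wd i j i≤j = subst₂ _≤_ (u≗v j) (u≗v i) (wd i j i≤j)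

  argmax : (f : Fin m → ℤ) → Fin m → ∃[ p ] (∀ j → f j ≤ f p)
  argmax {suc zero}    f _ = zero , λ { zero → ℤP.≤-refl }
  argmax {suc (suc m)} f _ with argmax (f ∘ suc) zero
  ... | p , max with f (suc p) ℤP.≤? f zero
  ...   | yes fp≤f0 = zero , λ { zero → ℤP.≤-refl ; (suc j) → ℤP.≤-trans (max j) fp≤f0 }
  ...   | no  fp≰f0 = suc p , λ { zero → ℤP.<⇒≤ (ℤP.≰⇒> fp≰f0) ; (suc j) → max j }

  sortingPermutation : (v : Vec ℤ m) → ∃[ σ ] WeaklyDecreasing (permVec σ v)
  sortingPermutation {zero}  v = Perm.id , λ ()
  sortingPermutation {suc m} v =
    σ , WD-∷⁺ _ _ (λ j → subst (_≤ lookup v p) (sym (lookup-permVec σ v (suc j))) (max (σ ⟨$⟩ʳ suc j))) rest-sorted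
    where
    p : Fin (suc m)
    p = proj₁ (argmax (lookup v) zero)
    max : ∀ j → lookup v j ≤ lookup v p
    max = proj₂ (argmax (lookup v) zero)
    w : Vec ℤ (suc m)
    w = permVec (transpose zero p) v
    τ : Permutation′ m
    τ = proj₁ (sortingPermutation (Vec.tail w))
    σ : Permutation′ (suc m)
    σ = lift₀ τ ∘ₚ transpose zero p
    rest-sorted : WeaklyDecreasing (Vec.tail (permVec σ v))
    rest-sorted =
      WD-resp {u = permVec τ (Vec.tail w)} {v = Vec.tail (permVec σ v)} same (proj₂ (sortingPermutation (Vec.tail w)))
      where
      same : ∀ c → lookup (permVec τ (Vec.tail w)) c ≡ lookup (Vec.tail (permVec σ v)) c
      same c = trans (VecP.lookup∘tabulate _ c) (trans (VecP.lookup∘tabulate _ (τ ⟨$⟩ʳ c)) (sym (VecP.lookup∘tabulate _ c)))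

  permutation-injective : (σ : Permutation′ m) → Injective _≡_ _≡_ (σ ⟨$⟩ʳ_)
  permutation-injective σ eq = trans (sym (Perm.inverseˡ σ)) (trans (cong (σ ⟨$⟩ˡ_) eq) (Perm.inverseˡ σ))

  rearrangement-≤ : (σ : Permutation′ m) (u v : Vec ℤ m) → WeaklyDecreasing u → WeaklyDecreasing v →
                    (∀ k → lookup u k ≡ lookup v (σ ⟨$⟩ʳ k)) → ∀ i → lookup u i ≤ lookup v i
  rearrangement-≤ σ u v u↘ v↘ u≡v∘σ i with FinP.injective⇒existsPivot (permutation-injective σ) i
  ... | k , k≤i , i≤σk = begin
    lookup u i          ≤⟨ u↘ k i k≤i ⟩
    lookup u k          ≡⟨ u≡v∘σ k ⟩
    lookup v (σ ⟨$⟩ʳ k) ≤⟨ v↘ i (σ ⟨$⟩ʳ k) i≤σk ⟩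
    lookup v i          ∎
    where open ℤP.≤-Reasoning

  sorted-rearrangement-unique : (σ : Permutation′ m) {u v : Vec ℤ m} → WeaklyDecreasing u → WeaklyDecreasing v →
                                (∀ k → lookup u k ≡ lookup v (σ ⟨$⟩ʳ k)) → u ≡ v
  sorted-rearrangement-unique σ {u} {v} u↘ v↘ u≡v∘σ = lookup-ext λ i →
    ℤP.≤-antisym (rearrangement-≤ σ u v u↘ v↘ u≡v∘σ i) (rearrangement-≤ (Perm.flip σ) v u v↘ u↘ v≡u∘σ⁻¹ i)
    where
    v≡u∘σ⁻¹ : ∀ k → lookup v k ≡ lookup u (σ ⟨$⟩ˡ k)
    v≡u∘σ⁻¹ k = trans (cong (lookup v) (sym (Perm.inverseʳ σ))) (sym (u≡v∘σ (σ ⟨$⟩ˡ k)))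

module SQNEnumeration where

  open import Defs using (WeaklyDecreasing; Config; SQN)
  open SortedVectors using (WD-∷⁺; WD-∷⁻)
  open import Data.Nat as ℕ using (ℕ; zero; suc; z≤n; _∸_)
  import Data.Nat.Properties as ℕP
  open import Data.Nat.Combinatorics using (_C_; nCk≡nC[n∸k]; nCn≡1; nCk+nC[k+1]≡[n+1]C[k+1])
  open import Data.Integer using (ℤ; +_; _≤_; +≤+)
  import Data.Integer.Properties as ℤP
  open import Data.Fin using (zero; suc)
  open import Data.Vec using (Vec; []; _∷_; lookup)
  import Data.Vec.Properties as VecP
  open import Data.List using (List; []; _∷_; _++_; map; length; cartesianProduct)
  import Data.List.Properties as ListP
  open import Data.List.Membership.Propositional using (_∈_)
  open import Data.List.Membership.Propositional.Properties
    using (∈-map⁺; ∈-map⁻; ∈-++⁺ˡ; ∈-++⁺ʳ; ∈-++⁻; ∈-cartesianProduct⁺; ∈-cartesianProduct⁻)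
  open import Data.List.Relation.Unary.Any using (here)
  open import Data.List.Relation.Unary.Unique.Propositional using (Unique)
  import Data.List.Relation.Unary.AllPairs as AllPairs
  import Data.List.Relation.Unary.All as All
  import Data.List.Relation.Unary.Unique.Propositional.Properties as UniqueP
  open import Data.Product using (_×_; _,_; proj₁; proj₂)
  open import Data.Sum using (inj₁; inj₂)
  open import Relation.Nullary using (yes; no; ¬_)
  open import Relation.Binary.PropositionalEquality
  open import Function.Bundles using (_⇔_; mk⇔)
  open import Function using (_∘_)

  private variable m : ℕ

  Bounded : ℕ → Vec ℤ m → Set
  Bounded B u = ∀ k → + 0 ≤ lookup u k × lookup u k ≤ + B

  -- Split by whether the first entry is below B or equal to it; the lengths then obey Pascal's rule.
  decreasingBounded : (m B : ℕ) → List (Vec ℤ m)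
  decreasingBounded zero    B       = [] ∷ []
  decreasingBounded (suc m) zero    = map (+ 0 ∷_) (decreasingBounded m zero)
  decreasingBounded (suc m) (suc B) =
    decreasingBounded (suc m) B ++ map (+ suc B ∷_) (decreasingBounded m (suc B))

  Bounded-∷ : ∀ {B x} {xs : Vec ℤ m} → + 0 ≤ x → x ≤ + B → Bounded B xs → Bounded B (x ∷ xs)
  Bounded-∷ 0≤x x≤B xs-bnd zero    = 0≤x , x≤B
  Bounded-∷ 0≤x x≤B xs-bnd (suc k) = xs-bnd k

  ∈-decreasingBounded⁻ : ∀ m B {u : Vec ℤ m} → u ∈ decreasingBounded m B → WeaklyDecreasing u × Bounded B u
  ∈-decreasingBounded⁻ zero B {[]} _ = (λ ()) , (λ ())
  ∈-decreasingBounded⁻ (suc m) zero u∈ with ∈-map⁻ (+ 0 ∷_) u∈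
  ... | xs , xs∈ , refl with ∈-decreasingBounded⁻ m zero xs∈
  ... | xs↘ , xs-bnd = WD-∷⁺ _ xs (λ k → proj₂ (xs-bnd k)) xs↘ , Bounded-∷ ℤP.≤-refl ℤP.≤-refl xs-bnd
  ∈-decreasingBounded⁻ (suc m) (suc B) u∈ with ∈-++⁻ (decreasingBounded (suc m) B) u∈
  ... | inj₁ u∈′ with ∈-decreasingBounded⁻ (suc m) B u∈′
  ...   | u↘ , u-bnd = u↘ , λ k → proj₁ (u-bnd k) , ℤP.≤-trans (proj₂ (u-bnd k)) (+≤+ (ℕP.n≤1+n B))
  ∈-decreasingBounded⁻ (suc m) (suc B) u∈ | inj₂ u∈′ with ∈-map⁻ (+ suc B ∷_) u∈′
  ... | xs , xs∈ , refl with ∈-decreasingBounded⁻ m (suc B) xs∈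
  ... | xs↘ , xs-bnd = WD-∷⁺ _ xs (λ k → proj₂ (xs-bnd k)) xs↘ , Bounded-∷ (+≤+ z≤n) ℤP.≤-refl xs-bnd

  ∈-decreasingBounded⁺ : ∀ m B {u : Vec ℤ m} → WeaklyDecreasing u → Bounded B u → u ∈ decreasingBounded m B
  ∈-decreasingBounded⁺ zero B {[]} _ _ = here refl
  ∈-decreasingBounded⁺ (suc m) zero {x ∷ xs} u↘ u-bnd =
    subst (λ h → h ∷ xs ∈ _) (ℤP.≤-antisym (proj₁ (u-bnd zero)) (proj₂ (u-bnd zero)))
      (∈-map⁺ (+ 0 ∷_) (∈-decreasingBounded⁺ m zero (proj₂ (WD-∷⁻ x xs u↘)) (u-bnd ∘ suc)))
  ∈-decreasingBounded⁺ (suc m) (suc B) {x ∷ xs} u↘ u-bnd with x ℤP.≤? + B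
  ... | yes x≤B = ∈-++⁺ˡ (∈-decreasingBounded⁺ (suc m) B u↘ u-bnd′)
    where
    u-bnd′ : Bounded B (x ∷ xs)
    u-bnd′ = Bounded-∷ (proj₁ (u-bnd zero)) x≤B
               (λ k → proj₁ (u-bnd (suc k)) , ℤP.≤-trans (proj₁ (WD-∷⁻ x xs u↘) k) x≤B)
  ... | no x≰B =
    subst (λ h → h ∷ xs ∈ _) (ℤP.≤-antisym (ℤP.i<j⇒suc[i]≤j (ℤP.≰⇒> x≰B)) (proj₂ (u-bnd zero)))
      (∈-++⁺ʳ (decreasingBounded (suc m) B)
        (∈-map⁺ (+ suc B ∷_) (∈-decreasingBounded⁺ m (suc B) (proj₂ (WD-∷⁻ x xs u↘)) (u-bnd ∘ suc))))

  decreasingBounded-unique : ∀ m B → Unique (decreasingBounded m B)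
  decreasingBounded-unique zero    B       = All.[] AllPairs.∷ AllPairs.[]
  decreasingBounded-unique (suc m) zero    = UniqueP.map⁺ VecP.∷-injectiveʳ (decreasingBounded-unique m zero)
  decreasingBounded-unique (suc m) (suc B) =
    UniqueP.++⁺ (decreasingBounded-unique (suc m) B)
                (UniqueP.map⁺ VecP.∷-injectiveʳ (decreasingBounded-unique m (suc B)))
                disjoint
    where
    disjoint : ∀ {u} → ¬ (u ∈ decreasingBounded (suc m) B × u ∈ map (+ suc B ∷_) (decreasingBounded m (suc B)))
    disjoint (u∈ , u∈′) with ∈-map⁻ (+ suc B ∷_) u∈′
    ... | _ , _ , refl with proj₂ (proj₂ (∈-decreasingBounded⁻ (suc m) B u∈) zero)
    ... | +≤+ sB≤B = ℕP.<-irrefl refl sB≤B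

  length-decreasingBounded : ∀ m B → length (decreasingBounded m B) ≡ (m ℕ.+ B) C m
  length-decreasingBounded zero    B       = refl
  length-decreasingBounded (suc m) zero    = begin
    length (map (+ 0 ∷_) (decreasingBounded m zero)) ≡⟨ ListP.length-map _ (decreasingBounded m zero) ⟩
    length (decreasingBounded m zero)                 ≡⟨ length-decreasingBounded m zero ⟩
    (m ℕ.+ 0) C m                                     ≡⟨ nC[n+0]≡1 m ⟩
    1                                                 ≡⟨ nC[n+0]≡1 (suc m) ⟨
    (suc m ℕ.+ 0) C suc m                             ∎
    where
    open ≡-Reasoning
    nC[n+0]≡1 : ∀ n → (n ℕ.+ 0) C n ≡ 1
    nC[n+0]≡1 n = trans (cong (_C n) (ℕP.+-identityʳ n)) (nCn≡1 n)
  length-decreasingBounded (suc m) (suc B) = begin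
    length (decreasingBounded (suc m) B ++ map (+ suc B ∷_) (decreasingBounded m (suc B)))
      ≡⟨ ListP.length-++ (decreasingBounded (suc m) B) ⟩
    length (decreasingBounded (suc m) B) ℕ.+ length (map (+ suc B ∷_) (decreasingBounded m (suc B)))
      ≡⟨ cong₂ ℕ._+_ (length-decreasingBounded (suc m) B)
                     (trans (ListP.length-map _ (decreasingBounded m (suc B))) (length-decreasingBounded m (suc B))) ⟩
    (suc m ℕ.+ B) C suc m ℕ.+ (m ℕ.+ suc B) C m
      ≡⟨ cong (λ k → k C suc m ℕ.+ (m ℕ.+ suc B) C m) (ℕP.+-suc m B) ⟨
    (m ℕ.+ suc B) C suc m ℕ.+ (m ℕ.+ suc B) C m
      ≡⟨ ℕP.+-comm ((m ℕ.+ suc B) C suc m) _ ⟩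
    (m ℕ.+ suc B) C m ℕ.+ (m ℕ.+ suc B) C suc m
      ≡⟨ nCk+nC[k+1]≡[n+1]C[k+1] (m ℕ.+ suc B) m ⟩
    suc (m ℕ.+ suc B) C suc m ∎
    where open ≡-Reasoning

  length-cartesianProduct : ∀ {A B : Set} (xs : List A) (ys : List B) →
                            length (cartesianProduct xs ys) ≡ length xs ℕ.* length ys
  length-cartesianProduct []       ys = refl
  length-cartesianProduct (x ∷ xs) ys = begin
    length (map (x ,_) ys ++ cartesianProduct xs ys)
      ≡⟨ ListP.length-++ (map (x ,_) ys) ⟩
    length (map (x ,_) ys) ℕ.+ length (cartesianProduct xs ys)
      ≡⟨ cong₂ ℕ._+_ (ListP.length-map (x ,_) ys) (length-cartesianProduct xs ys) ⟩
    length ys ℕ.+ length xs ℕ.* length ys ∎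
    where open ≡-Reasoning

  module _ (n d : ℕ) where

    sqnConfigs : List (Config n d)
    sqnConfigs = cartesianProduct (decreasingBounded n (n ℕ.+ d)) (decreasingBounded d n)

    sqnConfigs-unique : Unique sqnConfigs
    sqnConfigs-unique = UniqueP.cartesianProduct⁺ (decreasingBounded-unique n (n ℕ.+ d)) (decreasingBounded-unique d n)

    length-sqnConfigs : length sqnConfigs ≡ ((2 ℕ.* n ℕ.+ d) C n) ℕ.* ((n ℕ.+ d) C n)
    length-sqnConfigs = begin
      length sqnConfigs
        ≡⟨ length-cartesianProduct (decreasingBounded n (n ℕ.+ d)) (decreasingBounded d n) ⟩
      length (decreasingBounded n (n ℕ.+ d)) ℕ.* length (decreasingBounded d n)
        ≡⟨ cong₂ ℕ._*_ (length-decreasingBounded n (n ℕ.+ d)) (length-decreasingBounded d n) ⟩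
      ((n ℕ.+ (n ℕ.+ d)) C n) ℕ.* ((d ℕ.+ n) C d)
        ≡⟨ cong₂ (λ a b → (a C n) ℕ.* b) n+[n+d]≡2n+d [d+n]Cd≡[n+d]Cn ⟩
      ((2 ℕ.* n ℕ.+ d) C n) ℕ.* ((n ℕ.+ d) C n) ∎
      where
      open ≡-Reasoning
      n+[n+d]≡2n+d : n ℕ.+ (n ℕ.+ d) ≡ 2 ℕ.* n ℕ.+ d
      n+[n+d]≡2n+d = trans (sym (ℕP.+-assoc n n d)) (cong (λ k → n ℕ.+ k ℕ.+ d) (sym (ℕP.+-identityʳ n)))
      [d+n]Cd≡[n+d]Cn : (d ℕ.+ n) C d ≡ (n ℕ.+ d) C n
      [d+n]Cd≡[n+d]Cn = begin
        (d ℕ.+ n) C d             ≡⟨ nCk≡nC[n∸k] (ℕP.m≤m+n d n) ⟩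
        (d ℕ.+ n) C (d ℕ.+ n ∸ d) ≡⟨ cong ((d ℕ.+ n) C_) (ℕP.m+n∸m≡n d n) ⟩
        (d ℕ.+ n) C n             ≡⟨ cong (_C n) (ℕP.+-comm d n) ⟩
        (n ℕ.+ d) C n             ∎

    ∈-sqnConfigs⇔SQN : ∀ u → (u ∈ sqnConfigs) ⇔ SQN u
    ∈-sqnConfigs⇔SQN (uK , uI) = mk⇔ to from
      where
      to : (uK , uI) ∈ sqnConfigs → SQN (uK , uI)
      to u∈ with ∈-cartesianProduct⁻ (decreasingBounded n (n ℕ.+ d)) (decreasingBounded d n) u∈
      ... | uK∈ , uI∈ with ∈-decreasingBounded⁻ n (n ℕ.+ d) uK∈ | ∈-decreasingBounded⁻ d n uI∈
      ... | uK↘ , uK-bnd | uI↘ , uI-bnd =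
        (uK↘ , uI↘) , (proj₂ ∘ uK-bnd , proj₂ ∘ uI-bnd) , (proj₁ ∘ uK-bnd , proj₁ ∘ uI-bnd)
      from : SQN (uK , uI) → (uK , uI) ∈ sqnConfigs
      from ((uK↘ , uI↘) , (uK≤ , uI≤) , (uK≥0 , uI≥0)) = ∈-cartesianProduct⁺
        (∈-decreasingBounded⁺ n (n ℕ.+ d) uK↘ (λ k → uK≥0 k , uK≤ k))
        (∈-decreasingBounded⁺ d n uI↘ (λ i → uI≥0 i , uI≤ i))

module TopplingEquivalence where

  open import Defs
  open SortedVectors using (lookup-ext; lookup-permVec)
  open IntegerSums
  open import Data.Nat as ℕ using (ℕ; zero; suc)
  open import Data.Integer using (ℤ; +_; -_; _+_; _*_; _-_; 0ℤ; 1ℤ)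
  import Data.Integer.Properties as ℤP
  open import Data.Integer.Tactic.RingSolver using (solve-∀)
  open import Data.Fin using (Fin; zero; suc)
  open import Data.Fin.Permutation as Perm using (Permutation′; _⟨$⟩ʳ_; _⟨$⟩ˡ_; _∘ₚ_)
  open import Data.Vec using (lookup)
  import Data.Vec.Properties as VecP
  open import Data.Sum as Sum using (_⊎_; inj₁; inj₂)
  open import Data.Product using (_,_; proj₁; proj₂; ∃-syntax)
  open import Function using (_∘_)
  open import Relation.Binary.PropositionalEquality

  module _ {n d : ℕ} where

    at : Config n d → Fin n ⊎ Fin d → ℤ
    at u x = grains u (nonSink x)

    at-⊕ : ∀ (u v : Config n d) x → at (u ⊕ v) x ≡ at u x + at v x
    at-⊕ u v (inj₁ k) = VecP.lookup-zipWith _+_ k (proj₁ u) (proj₁ v)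
    at-⊕ u v (inj₂ i) = VecP.lookup-zipWith _+_ i (proj₂ u) (proj₂ v)

    at-· : ∀ z (u : Config n d) x → at (z · u) x ≡ z * at u x
    at-· z u (inj₁ k) = VecP.lookup-map k (z *_) (proj₁ u)
    at-· z u (inj₂ i) = VecP.lookup-map i (z *_) (proj₂ u)

    at-zeroC : ∀ x → at zeroC x ≡ 0ℤ
    at-zeroC (inj₁ k) = VecP.lookup-replicate k _
    at-zeroC (inj₂ i) = VecP.lookup-replicate i _

    at-ΣC : ∀ m (f : Fin m → Config n d) x → at (ΣC m f) x ≡ sum (λ j → at (f j) x)
    at-ΣC zero    f x = at-zeroC x
    at-ΣC (suc m) f x = trans (at-⊕ (f zero) (ΣC m (f ∘ suc)) x) (cong (_+_ (at (f zero) x)) (at-ΣC m (f ∘ suc) x))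

    at-Δ-sink : ∀ x → at (Δ sink) x ≡ 1ℤ
    at-Δ-sink (inj₁ k) = VecP.lookup-replicate k _
    at-Δ-sink (inj₂ i) = VecP.lookup-replicate i _

    at-toppleComb : ∀ (a : Vertex n d → ℤ) x → at (toppleComb a) x ≡
      a sink + (sum (λ k → a (kv k) * at (Δ (kv k)) x) + sum (λ i → a (iv i) * at (Δ (iv i)) x))
    at-toppleComb a x = begin
      at (toppleComb a) x
        ≡⟨ at-⊕ (a sink · Δ sink) _ x ⟩
      at (a sink · Δ sink) x + at (ΣC n (λ k → a (kv k) · Δ (kv k)) ⊕ ΣC d (λ i → a (iv i) · Δ (iv i))) x
        ≡⟨ cong₂ _+_ (trans (at-· (a sink) (Δ sink) x) (trans (cong (a sink *_) (at-Δ-sink x)) (ℤP.*-identityʳ (a sink))))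
                     (at-⊕ (ΣC n (λ k → a (kv k) · Δ (kv k))) _ x) ⟩
      a sink + (at (ΣC n (λ k → a (kv k) · Δ (kv k))) x + at (ΣC d (λ i → a (iv i) · Δ (iv i))) x)
        ≡⟨ cong (_+_ (a sink)) (cong₂ _+_
             (trans (at-ΣC n _ x) (sum-cong-≗ (λ k → at-· (a (kv k)) (Δ (kv k)) x)))
             (trans (at-ΣC d _ x) (sum-cong-≗ (λ i → at-· (a (iv i)) (Δ (iv i)) x)))) ⟩
      a sink + (sum (λ k → a (kv k) * at (Δ (kv k)) x) + sum (λ i → a (iv i) * at (Δ (iv i)) x)) ∎
      where open ≡-Reasoning

    at-toppleComb-kv : ∀ (a : Vertex n d → ℤ) k →
      at (toppleComb a) (inj₁ k) ≡ a sink + sum (a ∘ kv) + sum (a ∘ iv) - + suc (n ℕ.+ d) * a (kv k)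
    at-toppleComb-kv a k = begin
      at (toppleComb a) (inj₁ k)
        ≡⟨ at-toppleComb a (inj₁ k) ⟩
      a sink + (sum (λ j → a (kv j) * at (Δ (kv j)) (inj₁ k)) + sum (λ i → a (iv i) * at (Δ (iv i)) (inj₁ k)))
        ≡⟨ cong (_+_ (a sink)) (cong₂ _+_
             (trans (sum-cong-≗ (λ j → cong (a (kv j) *_) (VecP.lookup∘tabulate _ k))) (sum-*-if k _ 1ℤ (a ∘ kv)))
             (sum-cong-≗ (λ i → cong (a (iv i) *_) (VecP.lookup-replicate k 1ℤ)))) ⟩
      a sink + (sum (a ∘ kv) * 1ℤ + (- + (n ℕ.+ d) - 1ℤ) * a (kv k) + sum (λ i → a (iv i) * 1ℤ))
        ≡⟨ cong (λ t → a sink + (sum (a ∘ kv) * 1ℤ + (- + (n ℕ.+ d) - 1ℤ) * a (kv k) + t))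
                (sym (*-distribʳ-sum 1ℤ (a ∘ iv))) ⟩
      a sink + (sum (a ∘ kv) * 1ℤ + (- + (n ℕ.+ d) - 1ℤ) * a (kv k) + sum (a ∘ iv) * 1ℤ)
        ≡⟨ rearrange (a sink) (sum (a ∘ kv)) (sum (a ∘ iv)) (a (kv k)) (+ (n ℕ.+ d)) ⟩
      a sink + sum (a ∘ kv) + sum (a ∘ iv) - + suc (n ℕ.+ d) * a (kv k) ∎
      where
      open ≡-Reasoning
      rearrange : ∀ s A B z N → s + (A * 1ℤ + (- N - 1ℤ) * z + B * 1ℤ) ≡ s + A + B - (1ℤ + N) * z
      rearrange = solve-∀

    at-toppleComb-iv : ∀ (a : Vertex n d → ℤ) i →
      at (toppleComb a) (inj₂ i) ≡ a sink + sum (a ∘ kv) - + suc n * a (iv i)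
    at-toppleComb-iv a i = begin
      at (toppleComb a) (inj₂ i)
        ≡⟨ at-toppleComb a (inj₂ i) ⟩
      a sink + (sum (λ k → a (kv k) * at (Δ (kv k)) (inj₂ i)) + sum (λ j → a (iv j) * at (Δ (iv j)) (inj₂ i)))
        ≡⟨ cong (_+_ (a sink)) (cong₂ _+_
             (trans (sum-cong-≗ (λ k → cong (a (kv k) *_) (VecP.lookup-replicate i 1ℤ))) (sym (*-distribʳ-sum 1ℤ (a ∘ kv))))
             (trans (sum-cong-≗ (λ j → cong (a (iv j) *_) (VecP.lookup∘tabulate _ i))) (sum-*-if i _ 0ℤ (a ∘ iv)))) ⟩
      a sink + (sum (a ∘ kv) * 1ℤ + (sum (a ∘ iv) * 0ℤ + (- + suc n - 0ℤ) * a (iv i)))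
        ≡⟨ rearrange (a sink) (sum (a ∘ kv)) (sum (a ∘ iv)) (a (iv i)) (+ n) ⟩
      a sink + sum (a ∘ kv) - + suc n * a (iv i) ∎
      where
      open ≡-Reasoning
      rearrange : ∀ s A B z N → s + (A * 1ℤ + (B * 0ℤ + (- (1ℤ + N) - 0ℤ) * z)) ≡ s + A - (1ℤ + N) * z
      rearrange = solve-∀

    -- With α, β the numbers of topplings of the clique and independent vertices and
    -- R = a_s + Σ α (a_s those of the sink), a clique vertex gains R + Σ β − (n+d+1) α_k
    -- grains and an independent vertex R − (n+1) β_i; R is the level of the equivalence.
    record TPEquiv[_] (R : ℤ) (c u : Config n d) : Set where
      field
        σK  : Permutation′ n
        σI  : Permutation′ d
        α   : Fin n → ℤ
        β   : Fin d → ℤ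
        eqK : ∀ k → lookup (proj₁ u) k ≡ lookup (proj₁ c) (σK ⟨$⟩ʳ k) + (R + sum β - + suc (n ℕ.+ d) * α k)
        eqI : ∀ i → lookup (proj₂ u) i ≡ lookup (proj₂ c) (σI ⟨$⟩ʳ i) + (R - + suc n * β i)

    permConfig : Permutation′ n → Permutation′ d → Config n d → Config n d
    permConfig σK σI c = permVec σK (proj₁ c) , permVec σI (proj₂ c)

    private
      at-permuted-⊕ : ∀ (c : Config n d) σK σI (v : Config n d) x →
        at (permConfig σK σI c ⊕ v) x ≡
        at c (Sum.map (σK ⟨$⟩ʳ_) (σI ⟨$⟩ʳ_) x) + at v x
      at-permuted-⊕ c σK σI v (inj₁ k) =
        trans (at-⊕ (permConfig σK σI c) v (inj₁ k)) (cong (_+ at v (inj₁ k)) (lookup-permVec σK (proj₁ c) k))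
      at-permuted-⊕ c σK σI v (inj₂ i) =
        trans (at-⊕ (permConfig σK σI c) v (inj₂ i)) (cong (_+ at v (inj₂ i)) (lookup-permVec σI (proj₂ c) i))

    TPEquiv⇒TPEquiv[] : ∀ {c u : Config n d} → TPEquiv c u → ∃[ R ] TPEquiv[ R ] c u
    TPEquiv⇒TPEquiv[] {c} (σK , σI , a , refl) = a sink + sum (a ∘ kv) , record
      { σK = σK ; σI = σI ; α = a ∘ kv ; β = a ∘ iv
      ; eqK = λ k → trans (at-permuted-⊕ c σK σI (toppleComb a) (inj₁ k))
                          (cong (_+_ (lookup (proj₁ c) (σK ⟨$⟩ʳ k))) (at-toppleComb-kv a k))
      ; eqI = λ i → trans (at-permuted-⊕ c σK σI (toppleComb a) (inj₂ i))
                          (cong (_+_ (lookup (proj₂ c) (σI ⟨$⟩ʳ i))) (at-toppleComb-iv a i))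
      }

    TPEquiv[]⇒TPEquiv : ∀ {R} {c u : Config n d} → TPEquiv[ R ] c u → TPEquiv c u
    TPEquiv[]⇒TPEquiv {R} {c} {u} e = σK , σI , a , cong₂ _,_ (lookup-ext onK) (lookup-ext onI)
      where
      open TPEquiv[_] e
      a : Vertex n d → ℤ
      a sink   = R - sum α
      a (kv k) = α k
      a (iv i) = β i
      R≡a-sink+Σα : R ≡ a sink + sum α
      R≡a-sink+Σα = m≡m-n+n R (sum α)
        where
        m≡m-n+n : ∀ m n → m ≡ m - n + n
        m≡m-n+n = solve-∀
      toppled : Config n d
      toppled = permConfig σK σI c ⊕ toppleComb a
      onK : ∀ k → lookup (proj₁ u) k ≡ at toppled (inj₁ k)
      onK k = begin
        lookup (proj₁ u) k
          ≡⟨ eqK k ⟩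
        lookup (proj₁ c) (σK ⟨$⟩ʳ k) + (R + sum β - + suc (n ℕ.+ d) * α k)
          ≡⟨ cong (λ t → lookup (proj₁ c) (σK ⟨$⟩ʳ k) + (t + sum β - + suc (n ℕ.+ d) * α k)) R≡a-sink+Σα ⟩
        lookup (proj₁ c) (σK ⟨$⟩ʳ k) + (a sink + sum α + sum β - + suc (n ℕ.+ d) * α k)
          ≡⟨ cong (_+_ (lookup (proj₁ c) (σK ⟨$⟩ʳ k))) (at-toppleComb-kv a k) ⟨
        lookup (proj₁ c) (σK ⟨$⟩ʳ k) + at (toppleComb a) (inj₁ k)
          ≡⟨ at-permuted-⊕ c σK σI (toppleComb a) (inj₁ k) ⟨
        at toppled (inj₁ k) ∎
        where open ≡-Reasoning
      onI : ∀ i → lookup (proj₂ u) i ≡ at toppled (inj₂ i)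
      onI i = begin
        lookup (proj₂ u) i
          ≡⟨ eqI i ⟩
        lookup (proj₂ c) (σI ⟨$⟩ʳ i) + (R - + suc n * β i)
          ≡⟨ cong (λ t → lookup (proj₂ c) (σI ⟨$⟩ʳ i) + (t - + suc n * β i)) R≡a-sink+Σα ⟩
        lookup (proj₂ c) (σI ⟨$⟩ʳ i) + (a sink + sum α - + suc n * β i)
          ≡⟨ cong (_+_ (lookup (proj₂ c) (σI ⟨$⟩ʳ i))) (at-toppleComb-iv a i) ⟨
        lookup (proj₂ c) (σI ⟨$⟩ʳ i) + at (toppleComb a) (inj₂ i)
          ≡⟨ at-permuted-⊕ c σK σI (toppleComb a) (inj₂ i) ⟨
        at toppled (inj₂ i) ∎
        where open ≡-Reasoning

    private
      no-topplingsK : ∀ x → x ≡ x + (0ℤ + sum {d} (λ _ → 0ℤ) - + suc (n ℕ.+ d) * 0ℤ)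
      no-topplingsK x =
        sym (trans (cong (λ t → x + (0ℤ + t - + suc (n ℕ.+ d) * 0ℤ)) (sum-zero d)) (x+[0+0-N*0]≡x x (+ suc (n ℕ.+ d))))
        where
        x+[0+0-N*0]≡x : ∀ x N → x + (0ℤ + 0ℤ - N * 0ℤ) ≡ x
        x+[0+0-N*0]≡x = solve-∀
      no-topplingsI : ∀ x → x ≡ x + (0ℤ - + suc n * 0ℤ)
      no-topplingsI x = sym (x+[0-N*0]≡x x (+ suc n))
        where
        x+[0-N*0]≡x : ∀ x N → x + (0ℤ - N * 0ℤ) ≡ x
        x+[0-N*0]≡x = solve-∀

    TPEquiv[]-refl : ∀ (c : Config n d) → TPEquiv[ 0ℤ ] c c
    TPEquiv[]-refl c = record
      { σK = Perm.id ; σI = Perm.id ; α = λ _ → 0ℤ ; β = λ _ → 0ℤ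
      ; eqK = λ k → no-topplingsK (lookup (proj₁ c) k)
      ; eqI = λ i → no-topplingsI (lookup (proj₂ c) i)
      }

    TPEquiv[]-permute : ∀ (c : Config n d) σK σI → TPEquiv[ 0ℤ ] c (permConfig σK σI c)
    TPEquiv[]-permute c σK σI = record
      { σK = σK ; σI = σI ; α = λ _ → 0ℤ ; β = λ _ → 0ℤ
      ; eqK = λ k → trans (lookup-permVec σK (proj₁ c) k) (no-topplingsK _)
      ; eqI = λ i → trans (lookup-permVec σI (proj₂ c) i) (no-topplingsI _)
      }

    TPEquiv[]-sym : ∀ {R} {c u : Config n d} → TPEquiv[ R ] c u → TPEquiv[ - R ] u c
    TPEquiv[]-sym {R} {c} {u} e = record
      { σK = Perm.flip σK ; σI = Perm.flip σI
      ; α = λ k → - α (σK ⟨$⟩ˡ k) ; β = λ i → - β (σI ⟨$⟩ˡ i)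
      ; eqK = λ k → begin
          lookup (proj₁ c) k
            ≡⟨ cong (lookup (proj₁ c)) (Perm.inverseʳ σK) ⟨
          lookup (proj₁ c) (σK ⟨$⟩ʳ (σK ⟨$⟩ˡ k))
            ≡⟨ invertK R (sum β) (N) (α (σK ⟨$⟩ˡ k)) (eqK (σK ⟨$⟩ˡ k)) ⟩
          lookup (proj₁ u) (σK ⟨$⟩ˡ k) + (- R + - sum β - N * - α (σK ⟨$⟩ˡ k))
            ≡⟨ cong (λ t → lookup (proj₁ u) (σK ⟨$⟩ˡ k) + (- R + t - N * - α (σK ⟨$⟩ˡ k))) -Σβ≡Σβ′ ⟩
          lookup (proj₁ u) (σK ⟨$⟩ˡ k) + (- R + sum (λ i → - β (σI ⟨$⟩ˡ i)) - N * - α (σK ⟨$⟩ˡ k)) ∎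
      ; eqI = λ i → begin
          lookup (proj₂ c) i
            ≡⟨ cong (lookup (proj₂ c)) (Perm.inverseʳ σI) ⟨
          lookup (proj₂ c) (σI ⟨$⟩ʳ (σI ⟨$⟩ˡ i))
            ≡⟨ invertI R (+ suc n) (β (σI ⟨$⟩ˡ i)) (eqI (σI ⟨$⟩ˡ i)) ⟩
          lookup (proj₂ u) (σI ⟨$⟩ˡ i) + (- R - + suc n * - β (σI ⟨$⟩ˡ i)) ∎
      }
      where
      open TPEquiv[_] e
      open ≡-Reasoning
      N : ℤ
      N = + suc (n ℕ.+ d)
      -Σβ≡Σβ′ : - sum β ≡ sum (λ i → - β (σI ⟨$⟩ˡ i))
      -Σβ≡Σβ′ = trans (cong -_ (sum-permute β (Perm.flip σI))) (sym (sum-neg (β ∘ (σI ⟨$⟩ˡ_))))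
      invertK : ∀ {x y} R B N a → y ≡ x + (R + B - N * a) → x ≡ y + (- R + - B - N * - a)
      invertK {x} R B N a refl = lemma x R B N a
        where
        lemma : ∀ x R B N a → x ≡ x + (R + B - N * a) + (- R + - B - N * - a)
        lemma = solve-∀
      invertI : ∀ {x y} R N b → y ≡ x + (R - N * b) → x ≡ y + (- R - N * - b)
      invertI {x} R N b refl = lemma x R N b
        where
        lemma : ∀ x R N b → x ≡ x + (R - N * b) + (- R - N * - b)
        lemma = solve-∀

    TPEquiv[]-trans : ∀ {R R′} {c u w : Config n d} → TPEquiv[ R ] c u → TPEquiv[ R′ ] u w → TPEquiv[ R + R′ ] c w
    TPEquiv[]-trans {R} {R′} {c} {u} {w} e e′ = record
      { σK = T.σK ∘ₚ S.σK ; σI = T.σI ∘ₚ S.σI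
      ; α = λ k → S.α (T.σK ⟨$⟩ʳ k) + T.α k ; β = λ i → S.β (T.σI ⟨$⟩ʳ i) + T.β i
      ; eqK = λ k → begin
          lookup (proj₁ w) k
            ≡⟨ T.eqK k ⟩
          lookup (proj₁ u) (T.σK ⟨$⟩ʳ k) + (R′ + sum T.β - N * T.α k)
            ≡⟨ cong (_+ (R′ + sum T.β - N * T.α k)) (S.eqK (T.σK ⟨$⟩ʳ k)) ⟩
          c∘σK k + (R + sum S.β - N * Sα∘Tσ k) + (R′ + sum T.β - N * T.α k)
            ≡⟨ combineK (c∘σK k) R R′ (sum S.β) (sum T.β) N (Sα∘Tσ k) (T.α k) ⟩
          c∘σK k + (R + R′ + (sum S.β + sum T.β) - N * (Sα∘Tσ k + T.α k))
            ≡⟨ cong (λ t → c∘σK k + (R + R′ + t - N * (Sα∘Tσ k + T.α k))) Σβ+Σβ′ ⟩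
          c∘σK k + (R + R′ + sum (λ i → S.β (T.σI ⟨$⟩ʳ i) + T.β i) - N * (Sα∘Tσ k + T.α k)) ∎
      ; eqI = λ i → begin
          lookup (proj₂ w) i
            ≡⟨ T.eqI i ⟩
          lookup (proj₂ u) (T.σI ⟨$⟩ʳ i) + (R′ - + suc n * T.β i)
            ≡⟨ cong (_+ (R′ - + suc n * T.β i)) (S.eqI (T.σI ⟨$⟩ʳ i)) ⟩
          c∘σI i + (R - + suc n * S.β (T.σI ⟨$⟩ʳ i)) + (R′ - + suc n * T.β i)
            ≡⟨ combineI (c∘σI i) R R′ (+ suc n) (S.β (T.σI ⟨$⟩ʳ i)) (T.β i) ⟩
          c∘σI i + (R + R′ - + suc n * (S.β (T.σI ⟨$⟩ʳ i) + T.β i)) ∎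
      }
      where
      module S = TPEquiv[_] e
      module T = TPEquiv[_] e′
      open ≡-Reasoning
      N : ℤ
      N = + suc (n ℕ.+ d)
      c∘σK : Fin n → ℤ
      c∘σK k = lookup (proj₁ c) (S.σK ⟨$⟩ʳ (T.σK ⟨$⟩ʳ k))
      c∘σI : Fin d → ℤ
      c∘σI i = lookup (proj₂ c) (S.σI ⟨$⟩ʳ (T.σI ⟨$⟩ʳ i))
      Sα∘Tσ : Fin n → ℤ
      Sα∘Tσ k = S.α (T.σK ⟨$⟩ʳ k)
      Σβ+Σβ′ : sum S.β + sum T.β ≡ sum (λ i → S.β (T.σI ⟨$⟩ʳ i) + T.β i)
      Σβ+Σβ′ = trans (cong (_+ sum T.β) (sum-permute S.β T.σI)) (sym (∑-distrib-+ (S.β ∘ (T.σI ⟨$⟩ʳ_)) T.β))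
      combineK : ∀ x R R′ B B′ N a a′ →
                 x + (R + B - N * a) + (R′ + B′ - N * a′) ≡ x + (R + R′ + (B + B′) - N * (a + a′))
      combineK = solve-∀
      combineI : ∀ x R R′ N b b′ → x + (R - N * b) + (R′ - N * b′) ≡ x + (R + R′ - N * (b + b′))
      combineI = solve-∀

    TPEquiv[]-shift : ∀ {R} {c u : Config n d} q → TPEquiv[ R ] c u → TPEquiv[ R - q * + suc n ] c u
    TPEquiv[]-shift {R} {c} {u} q e = record
      { σK = σK ; σI = σI ; α = λ k → α k - q ; β = λ i → β i - q
      ; eqK = λ k → begin
          lookup (proj₁ u) k
            ≡⟨ eqK k ⟩
          lookup (proj₁ c) (σK ⟨$⟩ʳ k) + (R + sum β - + suc (n ℕ.+ d) * α k)
            ≡⟨ cong (_+_ (lookup (proj₁ c) (σK ⟨$⟩ʳ k))) (shiftK R (sum β) (α k) q (+ n) (+ d)) ⟩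
          lookup (proj₁ c) (σK ⟨$⟩ʳ k) + (R - q * + suc n + (sum β + + d * - q) - + suc (n ℕ.+ d) * (α k - q))
            ≡⟨ cong (λ t → lookup (proj₁ c) (σK ⟨$⟩ʳ k) + (R - q * + suc n + t - + suc (n ℕ.+ d) * (α k - q))) Σ[β-q] ⟨
          lookup (proj₁ c) (σK ⟨$⟩ʳ k) + (R - q * + suc n + sum (λ i → β i - q) - + suc (n ℕ.+ d) * (α k - q)) ∎
      ; eqI = λ i → trans (eqI i) (cong (_+_ (lookup (proj₂ c) (σI ⟨$⟩ʳ i))) (shiftI R (β i) q (+ n)))
      }
      where
      open TPEquiv[_] e
      open ≡-Reasoning
      Σ[β-q] : sum (λ i → β i - q) ≡ sum β + + d * - q
      Σ[β-q] = trans (∑-distrib-+ β (λ _ → - q)) (cong (_+_ (sum β)) (sum-const d (- q)))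
      shiftK : ∀ R B a q n d → R + B - (1ℤ + (n + d)) * a ≡ R - q * (1ℤ + n) + (B + d * - q) - (1ℤ + (n + d)) * (a - q)
      shiftK = solve-∀
      shiftI : ∀ R b q n → R - (1ℤ + n) * b ≡ R - q * (1ℤ + n) - (1ℤ + n) * (b - q)
      shiftI = solve-∀

module ForbiddenSubconfigurations where

  open import Defs
  open IntegerSums
  open TopplingEquivalence using (at; at-⊕; at-ΣC; at-Δ-sink; at-zeroC)
  open import Data.Nat as ℕ using (ℕ; zero; suc; _<ᵇ_)
  import Data.Nat.Properties as ℕP
  open import Data.Integer using (ℤ; +_; -_; _+_; _-_; _≤_; +≤+; 0ℤ; 1ℤ)
  import Data.Integer.Properties as ℤP
  open import Data.Integer.Tactic.RingSolver using (solve-∀)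
  open import Data.Fin using (Fin; zero; suc; toℕ)
  import Data.Fin.Properties as FinP
  import Data.Vec.Properties as VecP
  open import Data.Bool using (Bool; true; false; if_then_else_; T)
  open import Data.Sum using (_⊎_; inj₁; inj₂)
  open import Data.Product using (_×_; _,_; ∃-syntax)
  open import Data.Empty using (⊥-elim)
  open import Function using (_∘_)
  open import Function.Bundles using (_⤖_; Bijection)
  open import Relation.Nullary.Decidable using (dec-false)
  open import Relation.Binary.PropositionalEquality

  firstTrue : ∀ {m} (P : Fin m → Bool) i₀ → P i₀ ≡ true →
              ∃[ i ] (P i ≡ true × (∀ j → toℕ j ℕ.< toℕ i → P j ≡ false))
  firstTrue {suc m} P i₀ Pi₀ with P zero in P0
  firstTrue {suc m} P i₀       Pi₀ | true  = zero , P0 , λ j ()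
  firstTrue {suc m} P zero     Pi₀ | false = ⊥-elim (false≢true (trans (sym P0) Pi₀))
    where
    false≢true : false ≢ true
    false≢true ()
  firstTrue {suc m} P (suc i₀) Pi₀ | false with firstTrue (P ∘ suc) i₀ Pi₀
  ... | i , Pi , before = suc i , Pi , λ { zero _ → P0 ; (suc j) (ℕ.s≤s j<i) → before j j<i }

  toℕ-≡ᵇ-false : ∀ {m} {a b : Fin m} → a ≢ b → (toℕ a ℕ.≡ᵇ toℕ b) ≡ false
  toℕ-≡ᵇ-false {a = a} {b} a≢b = dec-false (toℕ a ℕ.≟ toℕ b) (a≢b ∘ FinP.toℕ-injective)

  module _ {n d : ℕ} where

    -- Adjacency of non-sink vertices, meaningful only for x ≢ y.
    edge : Fin n ⊎ Fin d → Fin n ⊎ Fin d → ℤ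
    edge (inj₁ _) _        = 1ℤ
    edge (inj₂ _) (inj₁ _) = 1ℤ
    edge (inj₂ _) (inj₂ _) = 0ℤ

    at-Δ-nonSink : ∀ {x y} → x ≢ y → at (Δ (nonSink y)) x ≡ edge x y
    at-Δ-nonSink {inj₁ k} {inj₁ k′} k≢k′ =
      trans (VecP.lookup∘tabulate _ k) (cong (λ b → if b then - + (n ℕ.+ d) else 1ℤ) (toℕ-≡ᵇ-false (k≢k′ ∘ cong inj₁)))
    at-Δ-nonSink {inj₁ k} {inj₂ i}  _ = VecP.lookup-replicate k 1ℤ
    at-Δ-nonSink {inj₂ i} {inj₁ k}  _ = VecP.lookup-replicate i 1ℤ
    at-Δ-nonSink {inj₂ i} {inj₂ i′} i≢i′ =
      trans (VecP.lookup∘tabulate _ i) (cong (λ b → if b then - + suc n else 0ℤ) (toℕ-≡ᵇ-false (i≢i′ ∘ cong inj₂)))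

    #K #I : (Fin n ⊎ Fin d → Bool) → ℤ
    #K S = sum (λ k → ⟦ S (inj₁ k) ⟧)
    #I S = sum (λ i → ⟦ S (inj₂ i) ⟧)

    -- Meaningful only for x ∈ S: the −1 discounts x itself.
    neighboursIn : (Fin n ⊎ Fin d → Bool) → Fin n ⊎ Fin d → ℤ
    neighboursIn S (inj₁ _) = #K S + #I S - 1ℤ
    neighboursIn S (inj₂ _) = #K S

    NoForbiddenSubconfig : Config n d → Set
    NoForbiddenSubconfig u = ∀ (S : Fin n ⊎ Fin d → Bool) x₀ → S x₀ ≡ true →
                             ∃[ x ] (S x ≡ true × neighboursIn S x ≤ at u x)

    edgesOutside : (Fin n ⊎ Fin d → Bool) → Fin n ⊎ Fin d → Fin n ⊎ Fin d → ℤ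
    edgesOutside S x y = if S y then 0ℤ else edge x y

    -- The sink is a neighbour of every x, outside every S.
    1+edgesOutside : ∀ S x → 1ℤ + (sum (edgesOutside S x ∘ inj₁) + sum (edgesOutside S x ∘ inj₂)) ≡
                             + deg (nonSink x) - neighboursIn S x
    1+edgesOutside S (inj₁ k) = begin
      1ℤ + (sum (edgesOutside S (inj₁ k) ∘ inj₁) + sum (edgesOutside S (inj₁ k) ∘ inj₂))
        ≡⟨ cong (_+_ 1ℤ) (cong₂ _+_ (sum-if-0-1 (S ∘ inj₁)) (sum-if-0-1 (S ∘ inj₂))) ⟩
      1ℤ + (+ n - #K S + (+ d - #I S))
        ≡⟨ rearrange (+ n) (+ d) (#K S) (#I S) ⟩
      + n + + d - (#K S + #I S - 1ℤ) ∎
      where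
      open ≡-Reasoning
      rearrange : ∀ n d x y → 1ℤ + (n - x + (d - y)) ≡ n + d - (x + y - 1ℤ)
      rearrange = solve-∀
    1+edgesOutside S (inj₂ i) = begin
      1ℤ + (sum (edgesOutside S (inj₂ i) ∘ inj₁) + sum (edgesOutside S (inj₂ i) ∘ inj₂))
        ≡⟨ cong (_+_ 1ℤ) (cong₂ _+_ (sum-if-0-1 (S ∘ inj₁)) (trans (sum-cong-≗ (if-same ∘ S ∘ inj₂)) (sum-zero d))) ⟩
      1ℤ + (+ n - #K S + 0ℤ)
        ≡⟨ rearrange (+ n) (#K S) ⟩
      1ℤ + + n - #K S ∎
      where
      open ≡-Reasoning
      if-same : ∀ b → (if b then 0ℤ else 0ℤ) ≡ 0ℤ
      if-same true  = refl
      if-same false = refl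
      rearrange : ∀ n x → 1ℤ + (n - x + 0ℤ) ≡ 1ℤ + n - x
      rearrange = solve-∀

    edgesOutside≥0 : ∀ S x y → 0ℤ ≤ edgesOutside S x y
    edgesOutside≥0 S x y with S y
    ... | true = ℤP.≤-refl
    edgesOutside≥0 S (inj₁ _) y        | false = +≤+ ℕ.z≤n
    edgesOutside≥0 S (inj₂ _) (inj₁ _) | false = +≤+ ℕ.z≤n
    edgesOutside≥0 S (inj₂ _) (inj₂ _) | false = ℤP.≤-refl

    topplingsBefore : (Fin (n ℕ.+ d) ⤖ (Fin n ⊎ Fin d)) → Fin (n ℕ.+ d) → Config n d
    topplingsBefore ord i =
      Δ sink ⊕ ΣC (n ℕ.+ d) (λ j → if toℕ j <ᵇ toℕ i then Δ (nonSink (Bijection.to ord j)) else zeroC)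

    at-topplingsBefore-first : ∀ ord S i → (∀ j → toℕ j ℕ.< toℕ i → S (Bijection.to ord j) ≡ false) →
      let v = Bijection.to ord i in at (topplingsBefore ord i) v ≤ + deg (nonSink v) - neighboursIn S v
    at-topplingsBefore-first ord S i outside = begin
      at (topplingsBefore ord i) v
        ≡⟨ at-⊕ (Δ sink) _ v ⟩
      at (Δ sink) v + at (ΣC (n ℕ.+ d) F) v
        ≡⟨ cong₂ _+_ (at-Δ-sink v) (at-ΣC (n ℕ.+ d) F v) ⟩
      1ℤ + sum (λ j → at (F j) v)
        ≤⟨ ℤP.+-monoʳ-≤ 1ℤ (sum-mono-≤ at-F≤) ⟩
      1ℤ + sum (edgesOutside S v ∘ to)
        ≡⟨ cong (_+_ 1ℤ) (sum-bijection ord (edgesOutside S v)) ⟩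
      1ℤ + (sum (edgesOutside S v ∘ inj₁) + sum (edgesOutside S v ∘ inj₂))
        ≡⟨ 1+edgesOutside S v ⟩
      + deg (nonSink v) - neighboursIn S v ∎
      where
      open ℤP.≤-Reasoning
      to : Fin (n ℕ.+ d) → Fin n ⊎ Fin d
      to = Bijection.to ord
      v : Fin n ⊎ Fin d
      v = to i
      F : Fin (n ℕ.+ d) → Config n d
      F j = if toℕ j <ᵇ toℕ i then Δ (nonSink (to j)) else zeroC
      at-F≤ : ∀ j → at (F j) v ≤ edgesOutside S v (to j)
      at-F≤ j with toℕ j <ᵇ toℕ i in j<ᵇi
      ... | false = subst (_≤ edgesOutside S v (to j)) (sym (at-zeroC v)) (edgesOutside≥0 S v (to j))
      ... | true  = earlier j (ℕP.<ᵇ⇒< (toℕ j) (toℕ i) (subst T (sym j<ᵇi) _))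
        where
        earlier : ∀ j → toℕ j ℕ.< toℕ i → at (Δ (nonSink (to j))) v ≤ edgesOutside S v (to j)
        earlier j j<i rewrite outside j j<i = ℤP.≤-reflexive (at-Δ-nonSink v≢to-j)
          where
          v≢to-j : v ≢ to j
          v≢to-j v≡to-j = ℕP.<-irrefl (cong toℕ (Bijection.injective ord (sym v≡to-j))) j<i

    -- The first vertex of S in the toppling order became unstable on grains from the sink and from outside S only.
    recurrent⇒noForbiddenSubconfig : ∀ {c : Config n d} → Recurrent c → NoForbiddenSubconfig c
    recurrent⇒noForbiddenSubconfig {c} (_ , ord , unstable) S x₀ Sx₀
      with Bijection.strictlySurjective ord x₀
    ... | i₀ , to-i₀≡x₀ with firstTrue (S ∘ Bijection.to ord) i₀ (trans (cong S to-i₀≡x₀) Sx₀)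
    ... | i , Sv , outside = v , Sv , cancel (ℤP.≤-trans (unstable i) grains-v≤)
      where
      v : Fin n ⊎ Fin d
      v = Bijection.to ord i
      grains-v≤ : at (c ⊕ topplingsBefore ord i) v ≤ at c v + (+ deg (nonSink v) - neighboursIn S v)
      grains-v≤ = begin
        at (c ⊕ topplingsBefore ord i) v                  ≡⟨ at-⊕ c (topplingsBefore ord i) v ⟩
        at c v + at (topplingsBefore ord i) v             ≤⟨ ℤP.+-monoʳ-≤ (at c v) (at-topplingsBefore-first ord S i outside) ⟩
        at c v + (+ deg (nonSink v) - neighboursIn S v)   ∎
        where open ℤP.≤-Reasoning
      cancel : ∀ {D a b} → D ≤ a + (D - b) → b ≤ a
      cancel {D} {a} {b} D≤ = subst₂ _≤_ (lhs D b) (rhs D a b) (ℤP.+-monoˡ-≤ (b - D) D≤)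
        where
        lhs : ∀ D b → D + (b - D) ≡ b
        lhs = solve-∀
        rhs : ∀ D a b → a + (D - b) + (b - D) ≡ a
        rhs = solve-∀

module LevelRigidity where

  open import Defs
  open SortedVectors using (argmax)
  open IntegerSums
  open TopplingEquivalence
  open ForbiddenSubconfigurations
  open import Data.Nat as ℕ using (ℕ; suc)
  open import Data.Integer using (ℤ; +_; -_; _+_; _*_; _-_; _≤_; _<_; 1ℤ; -1ℤ)
  import Data.Integer.Properties as ℤP
  open import Data.Integer.Tactic.RingSolver using (solve-∀)
  open import Data.Fin using (Fin; splitAt; join)
  import Data.Fin.Properties as FinP
  open import Data.Fin.Permutation as Perm using (_⟨$⟩ʳ_; _⟨$⟩ˡ_)
  open import Data.Vec using (lookup)
  open import Data.Sum using (_⊎_; inj₁; inj₂)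
  open import Data.Product using (_×_; _,_; proj₁; proj₂; ∃-syntax)
  open import Function using (_∘_)
  open import Data.Bool using (Bool; true)
  open import Relation.Nullary using (yes; no; does; ¬_)
  open import Relation.Nullary.Decidable using (dec-true)
  open import Relation.Binary.PropositionalEquality

  argmax-⊎ : ∀ {n d} (f : Fin n ⊎ Fin d → ℤ) → Fin n ⊎ Fin d → ∃[ p ] (∀ y → f y ≤ f p)
  argmax-⊎ {n} {d} f x₀ with argmax (f ∘ splitAt n) (join n d x₀)
  ... | p , max = splitAt n p , λ y → subst (_≤ f (splitAt n p)) (cong f (FinP.splitAt-join n d y)) (max (join n d y))

  <⇒-≤-1 : ∀ {x y} → x < y → x - y ≤ -1ℤ
  <⇒-≤-1 {x} {y} x<y = subst (x - y ≤_) (pred-y-y y) (ℤP.+-monoˡ-≤ (- y) (ℤP.i<j⇒i≤pred[j] x<y))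
    where
    pred-y-y : ∀ y → -1ℤ + y - y ≡ -1ℤ
    pred-y-y = solve-∀

  below-max-gap : ∀ {x M} → x ≤ M → x - M ≤ ⟦ does (x ℤP.≟ M) ⟧ - 1ℤ
  below-max-gap {x} {M} x≤M with x ℤP.≟ M
  ... | yes refl = ℤP.≤-reflexive (ℤP.+-inverseʳ x)
  ... | no  x≢M  = <⇒-≤-1 (ℤP.≤∧≢⇒< x≤M x≢M)

  sum-below-max : ∀ {m} (f : Fin m → ℤ) M → (∀ j → f j ≤ M) →
                  sum f - + m * M ≤ sum (λ j → ⟦ does (f j ℤP.≟ M) ⟧) - + m * 1ℤ
  sum-below-max f M f≤M =
    subst₂ _≤_ (sum-minus-const f M) (sum-minus-const (λ j → ⟦ does (f j ℤP.≟ M) ⟧) 1ℤ) (sum-mono-≤ (below-max-gap ∘ f≤M))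

  module _ {n d : ℕ} where

    module _ {R} {c u : Config n d} (c-stable : ∀ x → at c x < + deg (nonSink x)) (e : TPEquiv[ R ] c u) where

      open TPEquiv[_] e

      private
        a : Fin n ⊎ Fin d → ℤ
        a (inj₁ k) = α k
        a (inj₂ i) = β i

        aₛ : ℤ
        aₛ = R - sum α

        most-toppled-forbidden : ∀ M → (∀ y → a y ≤ M) → aₛ < M → ∀ x → a x ≡ M →
                                 at u x < neighboursIn (λ y → does (a y ℤP.≟ M)) x
        most-toppled-forbidden M max aₛ<M (inj₁ k) refl = ℤP.i≤pred[j]⇒i<j (begin
          at u (inj₁ k)
            ≡⟨ eqK k ⟩
          lookup (proj₁ c) (σK ⟨$⟩ʳ k) + (R + sum β - + suc (n ℕ.+ d) * α k)
            ≡⟨ regroup (lookup (proj₁ c) (σK ⟨$⟩ʳ k)) R (sum α) (sum β) (α k) (+ n) (+ d) ⟩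
          lookup (proj₁ c) (σK ⟨$⟩ʳ k) + (aₛ - α k) + (sum α - + n * α k) + (sum β - + d * α k)
            ≤⟨ ℤP.+-mono-≤ (ℤP.+-mono-≤ (ℤP.+-mono-≤ (ℤP.i<j⇒i≤pred[j] (c-stable (inj₁ (σK ⟨$⟩ʳ k)))) (<⇒-≤-1 aₛ<M))
                                        (sum-below-max α (α k) (max ∘ inj₁)))
                          (sum-below-max β (α k) (max ∘ inj₂)) ⟩
          -1ℤ + (+ n + + d) + -1ℤ + (#K S - + n * 1ℤ) + (#I S - + d * 1ℤ)
            ≡⟨ collect (+ n) (+ d) (#K S) (#I S) ⟩
          -1ℤ + (#K S + #I S - 1ℤ) ∎)
          where
          open ℤP.≤-Reasoning
          S : Fin n ⊎ Fin d → Bool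
          S y = does (a y ℤP.≟ α k)
          regroup : ∀ x R A B z n d → x + (R + B - (1ℤ + (n + d)) * z) ≡ x + (R - A - z) + (A - n * z) + (B - d * z)
          regroup = solve-∀
          collect : ∀ n d x y → -1ℤ + (n + d) + -1ℤ + (x - n * 1ℤ) + (y - d * 1ℤ) ≡ -1ℤ + (x + y - 1ℤ)
          collect = solve-∀
        most-toppled-forbidden M max aₛ<M (inj₂ i) refl = ℤP.i≤pred[j]⇒i<j (begin
          at u (inj₂ i)
            ≡⟨ eqI i ⟩
          lookup (proj₂ c) (σI ⟨$⟩ʳ i) + (R - + suc n * β i)
            ≡⟨ regroup (lookup (proj₂ c) (σI ⟨$⟩ʳ i)) R (sum α) (β i) (+ n) ⟩
          lookup (proj₂ c) (σI ⟨$⟩ʳ i) + (aₛ - β i) + (sum α - + n * β i)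
            ≤⟨ ℤP.+-mono-≤ (ℤP.+-mono-≤ (ℤP.i<j⇒i≤pred[j] (c-stable (inj₂ (σI ⟨$⟩ʳ i)))) (<⇒-≤-1 aₛ<M))
                          (sum-below-max α (β i) (max ∘ inj₁)) ⟩
          -1ℤ + (1ℤ + + n) + -1ℤ + (#K S - + n * 1ℤ)
            ≡⟨ collect (+ n) (#K S) ⟩
          -1ℤ + #K S ∎)
          where
          open ℤP.≤-Reasoning
          S : Fin n ⊎ Fin d → Bool
          S y = does (a y ℤP.≟ β i)
          regroup : ∀ x R A z n → x + (R - (1ℤ + n) * z) ≡ x + (R - A - z) + (A - n * z)
          regroup = solve-∀
          collect : ∀ n x → -1ℤ + (1ℤ + n) + -1ℤ + (x - n * 1ℤ) ≡ -1ℤ + x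
          collect = solve-∀

      sink-topples-most : NoForbiddenSubconfig u → (∀ k → α k ≤ R - sum α) × (∀ i → β i ≤ R - sum α)
      sink-topples-most u-nfs = (λ k → ℤP.≮⇒≥ (not-above (inj₁ k))) , (λ i → ℤP.≮⇒≥ (not-above (inj₂ i)))
        where
        not-above : ∀ x₁ → ¬ (aₛ < a x₁)
        not-above x₁ aₛ<ax₁ with argmax-⊎ a x₁
        ... | p , max with u-nfs (λ y → does (a y ℤP.≟ a p)) p (dec-true (a p ℤP.≟ a p) refl)
        ... | x , ax≟ap , nb≤ = ℤP.<-irrefl refl
          (ℤP.≤-<-trans nb≤ (most-toppled-forbidden (a p) max (ℤP.<-≤-trans aₛ<ax₁ (max x₁)) x (≟-true⇒≡ ax≟ap)))
          where
          ≟-true⇒≡ : ∀ {x y} → does (x ℤP.≟ y) ≡ true → x ≡ y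
          ≟-true⇒≡ {x} {y} eq with x ℤP.≟ y
          ≟-true⇒≡ eq | yes x≡y = x≡y
          ≟-true⇒≡ () | no _

    level-divisible : ∀ {R} {c u : Config n d} → Stable c → Stable u →
                      NoForbiddenSubconfig c → NoForbiddenSubconfig u → TPEquiv[ R ] c u → ∃[ q ] R ≡ q * + suc n
    level-divisible {R} c-stable u-stable c-nfs u-nfs e = aₛ , R≡aₛ[1+n]
      where
      open TPEquiv[_] e
      aₛ : ℤ
      aₛ = R - sum α
      α≤aₛ : ∀ k → α k ≤ aₛ
      α≤aₛ = proj₁ (sink-topples-most (proj₂ c-stable) e u-nfs)
      -α′≤-aₛ : ∀ k → - α (σK ⟨$⟩ˡ k) ≤ - aₛ
      -α′≤-aₛ k =
        subst (- α (σK ⟨$⟩ˡ k) ≤_) -R-Σα′≡-aₛ (proj₁ (sink-topples-most (proj₂ u-stable) (TPEquiv[]-sym e) c-nfs) k)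
        where
        -R-Σα′≡-aₛ : - R - sum (λ k → - α (σK ⟨$⟩ˡ k)) ≡ - aₛ
        -R-Σα′≡-aₛ = begin
          - R - sum (λ k → - α (σK ⟨$⟩ˡ k)) ≡⟨ cong (λ t → - R - t) (sum-neg (α ∘ (σK ⟨$⟩ˡ_))) ⟩
          - R - - sum (α ∘ (σK ⟨$⟩ˡ_))      ≡⟨ cong (λ t → - R - - t) (sum-permute α (Perm.flip σK)) ⟨
          - R - - sum α                     ≡⟨ negate R (sum α) ⟩
          - aₛ                              ∎
          where
          open ≡-Reasoning
          negate : ∀ R A → - R - - A ≡ - (R - A)
          negate = solve-∀
      α≡aₛ : ∀ k → α k ≡ aₛ
      α≡aₛ k =
        ℤP.≤-antisym (α≤aₛ k) (ℤP.neg-cancel-≤ (subst (λ j → - α j ≤ - aₛ) (Perm.inverseˡ σK) (-α′≤-aₛ (σK ⟨$⟩ʳ k))))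
      R≡aₛ[1+n] : R ≡ aₛ * + suc n
      R≡aₛ[1+n] = begin
        R                    ≡⟨ m≡m-n+n R (sum α) ⟩
        aₛ + sum α           ≡⟨ cong (_+_ aₛ) (trans (sum-cong-≗ α≡aₛ) (sum-const n aₛ)) ⟩
        aₛ + + n * aₛ        ≡⟨ factor aₛ (+ n) ⟩
        aₛ * + suc n         ∎
        where
        open ≡-Reasoning
        m≡m-n+n : ∀ m n → m ≡ m - n + n
        m≡m-n+n = solve-∀
        factor : ∀ a n → a + n * a ≡ a * (1ℤ + n)
        factor = solve-∀

module Representatives where

  open import Defs
  open SortedVectors using (sortingPermutation; sorted-rearrangement-unique; lookup-permVec)
  open IntegerSums
  open TopplingEquivalence
  open import Data.Nat as ℕ using (ℕ; zero; suc; z≤n)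
  import Data.Nat.Properties as ℕP
  open import Data.Integer using (ℤ; +_; -_; -[1+_]; +[1+_]; _+_; _*_; _-_; _≤_; +≤+; 0ℤ)
  import Data.Integer.Properties as ℤP
  open import Data.Integer.DivMod using (_%ℕ_; _/ℕ_; a≡a%ℕn+[a/ℕn]*n; n%ℕd<d)
  open import Data.Integer.Tactic.RingSolver using (solve-∀)
  open import Data.Fin using (Fin)
  open import Data.Fin.Permutation as Perm using (Permutation′; _⟨$⟩ʳ_)
  open import Data.Vec using (Vec; lookup; tabulate)
  import Data.Vec.Properties as VecP
  open import Data.Product using (_×_; _,_; proj₁; proj₂; Σ; ∃-syntax)
  open import Data.Empty using (⊥-elim)
  open import Function using (_∘_)
  open import Relation.Binary.PropositionalEquality

  multiple-in-range : ∀ B z → - + B ≤ + suc B * z → + suc B * z ≤ + B → z ≡ 0ℤ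
  multiple-in-range B (+ zero)  _  _  = refl
  multiple-in-range B +[1+ k ]  _  (+≤+ le) = ⊥-elim (ℕP.<⇒≱ (ℕP.n<1+n B) (ℕP.≤-trans (ℕP.m≤m*n (suc B) (suc k)) le))
  multiple-in-range B -[1+ k ]  ge _ = ⊥-elim (ℕP.<⇒≱ (ℕP.n<1+n B) (ℕP.≤-trans (ℕP.m≤m*n (suc B) (suc k)) le))
    where
    le : suc B ℕ.* suc k ℕ.≤ B
    le with ℤP.neg-cancel-≤ ge
    ... | +≤+ p = p

  residue-unique : ∀ B {x y} z → + 0 ≤ x → x ≤ + B → + 0 ≤ y → y ≤ + B → x ≡ y - + suc B * z → z ≡ 0ℤ
  residue-unique B {x} {y} z 0≤x x≤B 0≤y y≤B x≡y-Bz = multiple-in-range B z lower upper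
    where
    y-x≡Bz : y - x ≡ + suc B * z
    y-x≡Bz = trans (cong (_-_ y) x≡y-Bz) (y-[y-w]≡w y (+ suc B * z))
      where
      y-[y-w]≡w : ∀ y w → y - (y - w) ≡ w
      y-[y-w]≡w = solve-∀
    lower : - + B ≤ + suc B * z
    lower = subst₂ _≤_ (ℤP.+-identityˡ (- + B)) y-x≡Bz (ℤP.+-mono-≤ 0≤y (ℤP.neg-mono-≤ x≤B))
    upper : + suc B * z ≤ + B
    upper = subst₂ _≤_ y-x≡Bz (ℤP.+-identityʳ (+ B)) (ℤP.+-mono-≤ y≤B (ℤP.neg-mono-≤ 0≤x))

  %ℕ-as-difference : ∀ a N → + (a %ℕ suc N) ≡ a - + suc N * (a /ℕ suc N)
  %ℕ-as-difference a N = begin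
    + (a %ℕ suc N)
      ≡⟨ r≡r+qN-Nq (+ (a %ℕ suc N)) (a /ℕ suc N) (+ suc N) ⟩
    + (a %ℕ suc N) + (a /ℕ suc N) * + suc N - + suc N * (a /ℕ suc N)
      ≡⟨ cong (_- + suc N * (a /ℕ suc N)) (a≡a%ℕn+[a/ℕn]*n a (suc N)) ⟨
    a - + suc N * (a /ℕ suc N) ∎
    where
    open ≡-Reasoning
    r≡r+qN-Nq : ∀ r q N → r ≡ r + q * N - N * q
    r≡r+qN-Nq = solve-∀

  %ℕ-bounds : ∀ a N → + 0 ≤ + (a %ℕ suc N) × + (a %ℕ suc N) ≤ + N
  %ℕ-bounds a N = +≤+ z≤n , +≤+ (ℕ.s≤s⁻¹ (n%ℕd<d a (suc N)))

  permVec-∀ : ∀ {m} (P : ℤ → Set) (σ : Permutation′ m) (v : Vec ℤ m) →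
              (∀ k → P (lookup v k)) → ∀ k → P (lookup (permVec σ v) k)
  permVec-∀ P σ v Pv k = subst P (sym (lookup-permVec σ v k)) (Pv (σ ⟨$⟩ʳ k))

  module _ {n d : ℕ} where

    TPEquiv[0]-SQN⇒≡ : ∀ {u v : Config n d} → SQN u → SQN v → TPEquiv[ 0ℤ ] u v → u ≡ v
    TPEquiv[0]-SQN⇒≡ {u} {v} ((uK↘ , uI↘) , (uK≤ , uI≤) , (uK≥0 , uI≥0))
                             ((vK↘ , vI↘) , (vK≤ , vI≤) , (vK≥0 , vI≥0)) e =
      sym (cong₂ _,_ (sorted-rearrangement-unique σK vK↘ uK↘ vK≡uK∘σK) (sorted-rearrangement-unique σI vI↘ uI↘ vI≡uI∘σI))
      where
      open TPEquiv[_] e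
      uK∘σK : Fin n → ℤ
      uK∘σK k = lookup (proj₁ u) (σK ⟨$⟩ʳ k)
      uI∘σI : Fin d → ℤ
      uI∘σI i = lookup (proj₂ u) (σI ⟨$⟩ʳ i)
      no-topplings : ∀ y N → y - N * 0ℤ ≡ y
      no-topplings = solve-∀
      vI≡ : ∀ i → lookup (proj₂ v) i ≡ uI∘σI i - + suc n * β i
      vI≡ i = trans (eqI i) (cong (_+_ (uI∘σI i)) (ℤP.+-identityˡ _))
      β≡0 : ∀ i → β i ≡ 0ℤ
      β≡0 i = residue-unique n (β i) (vI≥0 i) (vI≤ i) (uI≥0 _) (uI≤ _) (vI≡ i)
      vI≡uI∘σI : ∀ i → lookup (proj₂ v) i ≡ uI∘σI i
      vI≡uI∘σI i = trans (vI≡ i) (trans (cong (λ b → uI∘σI i - + suc n * b) (β≡0 i)) (no-topplings (uI∘σI i) (+ suc n)))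
      vK≡ : ∀ k → lookup (proj₁ v) k ≡ uK∘σK k - + suc (n ℕ.+ d) * α k
      vK≡ k = begin
        lookup (proj₁ v) k                              ≡⟨ eqK k ⟩
        uK∘σK k + (0ℤ + sum β - + suc (n ℕ.+ d) * α k)  ≡⟨ cong (λ s → uK∘σK k + (0ℤ + s - + suc (n ℕ.+ d) * α k)) Σβ≡0 ⟩
        uK∘σK k + (0ℤ + 0ℤ - + suc (n ℕ.+ d) * α k)     ≡⟨ cong (_+_ (uK∘σK k)) (ℤP.+-identityˡ _) ⟩
        uK∘σK k - + suc (n ℕ.+ d) * α k                 ∎
        where
        open ≡-Reasoning
        Σβ≡0 : sum β ≡ 0ℤ
        Σβ≡0 = trans (sum-cong-≗ β≡0) (sum-zero d)
      α≡0 : ∀ k → α k ≡ 0ℤ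
      α≡0 k = residue-unique (n ℕ.+ d) (α k) (vK≥0 k) (vK≤ k) (uK≥0 _) (uK≤ _) (vK≡ k)
      vK≡uK∘σK : ∀ k → lookup (proj₁ v) k ≡ uK∘σK k
      vK≡uK∘σK k =
        trans (vK≡ k) (trans (cong (λ a → uK∘σK k - + suc (n ℕ.+ d) * a) (α≡0 k)) (no-topplings (uK∘σK k) (+ suc (n ℕ.+ d))))

    reduce : (c : Config n d) (t : ℕ) → Σ (Config n d) λ v → QuasiStable v × NonNegative v × TPEquiv[ + t ] c v
    reduce c t = v , (proj₂ ∘ boundsK , proj₂ ∘ boundsI) , (proj₁ ∘ boundsK , proj₁ ∘ boundsI) , record
      { σK = Perm.id ; σI = Perm.id ; α = α ; β = β
      ; eqK = λ k → trans (VecP.lookup∘tabulate _ k) (trans (%ℕ-as-difference (loadK k) (n ℕ.+ d))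
                      (reassoc (lookup (proj₁ c) k) (+ t) (sum β) (+ suc (n ℕ.+ d) * α k)))
      ; eqI = λ i → trans (VecP.lookup∘tabulate _ i) (trans (%ℕ-as-difference (loadI i) n)
                      (ℤP.+-assoc (lookup (proj₂ c) i) (+ t) (- (+ suc n * β i))))
      }
      where
      loadI : Fin d → ℤ
      loadI i = lookup (proj₂ c) i + + t
      β : Fin d → ℤ
      β i = loadI i /ℕ suc n
      loadK : Fin n → ℤ
      loadK k = lookup (proj₁ c) k + + t + sum β
      α : Fin n → ℤ
      α k = loadK k /ℕ suc (n ℕ.+ d)
      v : Config n d
      v = tabulate (λ k → + (loadK k %ℕ suc (n ℕ.+ d))) , tabulate (λ i → + (loadI i %ℕ suc n))
      boundsK : ∀ k → + 0 ≤ lookup (proj₁ v) k × lookup (proj₁ v) k ≤ + (n ℕ.+ d)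
      boundsK k rewrite VecP.lookup∘tabulate (λ k → + (loadK k %ℕ suc (n ℕ.+ d))) k = %ℕ-bounds (loadK k) (n ℕ.+ d)
      boundsI : ∀ i → + 0 ≤ lookup (proj₂ v) i × lookup (proj₂ v) i ≤ + n
      boundsI i rewrite VecP.lookup∘tabulate (λ i → + (loadI i %ℕ suc n)) i = %ℕ-bounds (loadI i) n
      reassoc : ∀ x t B Y → x + t + B - Y ≡ x + (t + B - Y)
      reassoc = solve-∀

    representative : (c : Config n d) (t : ℕ) → Σ (Config n d) λ s → SQN s × TPEquiv[ + t ] c s
    representative c t with reduce c t
    ... | v , (vK≤ , vI≤) , (vK≥0 , vI≥0) , e with sortingPermutation (proj₁ v) | sortingPermutation (proj₂ v)
    ... | σK , sK↘ | σI , sI↘ =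
      permConfig σK σI v ,
      ((sK↘ , sI↘) , (permVec-∀ (_≤ + (n ℕ.+ d)) σK (proj₁ v) vK≤ , permVec-∀ (_≤ + n) σI (proj₂ v) vI≤)
                  , (permVec-∀ (+ 0 ≤_) σK (proj₁ v) vK≥0 , permVec-∀ (+ 0 ≤_) σI (proj₂ v) vI≥0)) ,
      subst (λ R → TPEquiv[ R ] c (permConfig σK σI v)) (ℤP.+-identityʳ (+ t)) (TPEquiv[]-trans e (TPEquiv[]-permute v σK σI))

module EquivalenceClasses where

  open import Defs
  open TopplingEquivalence
  open ForbiddenSubconfigurations using (NoForbiddenSubconfig; recurrent⇒noForbiddenSubconfig)
  open LevelRigidity using (level-divisible)
  open Representatives
  open import Data.Nat as ℕ using (ℕ; suc; s≤s; z≤n)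
  open import Data.Integer using (ℤ; +_; -_; -[1+_]; _+_; _*_; _-_; _≤_; _<_; +≤+; -≤+; +<+; 0ℤ)
  import Data.Integer.Properties as ℤP
  open import Data.Integer.DivMod using (_%ℕ_; _/ℕ_; n%ℕd<d)
  open import Data.Integer.Tactic.RingSolver using (solve-∀)
  open import Data.Fin using (Fin; toℕ; fromℕ<)
  import Data.Fin.Properties as FinP
  open import Data.List using (List; map; allFin; length)
  import Data.List.Properties as ListP
  open import Data.List.Membership.Propositional using (_∈_)
  open import Data.List.Membership.Propositional.Properties using (∈-map⁺; ∈-map⁻; ∈-allFin)
  open import Data.List.Relation.Unary.Unique.Propositional using (Unique)
  import Data.List.Relation.Unary.Unique.Propositional.Properties as UniqueP
  open import Data.Sum using (inj₁; inj₂)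
  open import Data.Product using (_×_; _,_; proj₁; proj₂; ∃-syntax)
  open import Function using (_∘_)
  open import Function.Bundles using (_⇔_; mk⇔)
  open import Relation.Binary.PropositionalEquality

  <-suc⇒≤ : ∀ {x m} → x < + suc m → x ≤ + m
  <-suc⇒≤ {+ _}      (+<+ (s≤s x≤m)) = +≤+ x≤m
  <-suc⇒≤ { -[1+ _ ]} _               = -≤+

  module _ {n d : ℕ} where

    sorted-stable⇒SQN : ∀ {c : Config n d} → Sorted c → Stable c → SQN c
    sorted-stable⇒SQN c↘ (c≥0 , c<deg) = c↘ , (ℤP.<⇒≤ ∘ c<deg ∘ inj₁ , <-suc⇒≤ ∘ c<deg ∘ inj₂) , c≥0

    SQN-same-level⇒≡ : ∀ {R} {c u v : Config n d} → SQN u → SQN v → TPEquiv[ R ] c u → TPEquiv[ R ] c v → u ≡ v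
    SQN-same-level⇒≡ {R} u-sqn v-sqn e e′ =
      TPEquiv[0]-SQN⇒≡ u-sqn v-sqn (subst (λ R → TPEquiv[ R ] _ _) (ℤP.+-inverseˡ R) (TPEquiv[]-trans (TPEquiv[]-sym e) e′))

    residues-equal : ∀ {s t} → s ℕ.< suc n → t ℕ.< suc n → (∃[ q ] + s - + t ≡ q * + suc n) → s ≡ t
    residues-equal {s} {t} s<1+n t<1+n (q , s-t≡qN) = sym (ℤP.+-injective (begin
      + t                  ≡⟨ t≡s-Nq ⟩
      + s - + suc n * q    ≡⟨ cong (λ z → + s - + suc n * z) q≡0 ⟩
      + s - + suc n * 0ℤ   ≡⟨ x-N*0≡x (+ s) (+ suc n) ⟩
      + s                  ∎))
      where
      open ≡-Reasoning
      x-N*0≡x : ∀ x N → x - N * 0ℤ ≡ x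
      x-N*0≡x = solve-∀
      t≡s-Nq : + t ≡ + s - + suc n * q
      t≡s-Nq = trans (y≡x-[x-y] (+ s) (+ t)) (cong (_-_ (+ s)) (trans s-t≡qN (ℤP.*-comm q (+ suc n))))
        where
        y≡x-[x-y] : ∀ x y → y ≡ x - (x - y)
        y≡x-[x-y] = solve-∀
      q≡0 : q ≡ 0ℤ
      q≡0 = residue-unique n q (+≤+ z≤n) (+≤+ (ℕ.s≤s⁻¹ t<1+n)) (+≤+ z≤n) (+≤+ (ℕ.s≤s⁻¹ s<1+n)) t≡s-Nq

    module _ (c : Config n d) where

      representativeAt : Fin (suc n) → Config n d
      representativeAt t = proj₁ (representative c (toℕ t))

      representativeAt-SQN : ∀ t → SQN (representativeAt t)
      representativeAt-SQN t = proj₁ (proj₂ (representative c (toℕ t)))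

      representativeAt-level : ∀ t → TPEquiv[ + toℕ t ] c (representativeAt t)
      representativeAt-level t = proj₂ (proj₂ (representative c (toℕ t)))

      representatives : List (Config n d)
      representatives = map representativeAt (allFin (suc n))

      length-representatives : length representatives ≡ suc n
      length-representatives = trans (ListP.length-map representativeAt (allFin (suc n))) (ListP.length-tabulate {n = suc n} (λ t → t))

      SQN-TPEquiv[]⇒∈ : ∀ {R u} → SQN u → TPEquiv[ R ] c u → u ∈ representatives
      SQN-TPEquiv[]⇒∈ {R} {u} u-sqn e =
        subst (_∈ representatives) (SQN-same-level⇒≡ (representativeAt-SQN r) u-sqn (representativeAt-level r) e′)
          (∈-map⁺ representativeAt (∈-allFin r))
        where
        r : Fin (suc n)
        r = fromℕ< (n%ℕd<d R (suc n))
        R-qN≡r : R - R /ℕ suc n * + suc n ≡ + toℕ r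
        R-qN≡r = begin
          R - R /ℕ suc n * + suc n   ≡⟨ cong (_-_ R) (ℤP.*-comm (R /ℕ suc n) (+ suc n)) ⟩
          R - + suc n * (R /ℕ suc n) ≡⟨ %ℕ-as-difference R n ⟨
          + (R %ℕ suc n)             ≡⟨ cong +_ (FinP.toℕ-fromℕ< (n%ℕd<d R (suc n))) ⟨
          + toℕ r                    ∎
          where open ≡-Reasoning
        e′ : TPEquiv[ + toℕ r ] c u
        e′ = subst (λ R → TPEquiv[ R ] c u) R-qN≡r (TPEquiv[]-shift (R /ℕ suc n) e)

      ∈-representatives⇔ : ∀ u → (u ∈ representatives) ⇔ (SQN u × TPEquiv c u)
      ∈-representatives⇔ u = mk⇔ to (λ (u-sqn , e) → SQN-TPEquiv[]⇒∈ u-sqn (proj₂ (TPEquiv⇒TPEquiv[] e)))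
        where
        to : u ∈ representatives → SQN u × TPEquiv c u
        to u∈ with ∈-map⁻ representativeAt u∈
        ... | t , _ , refl = representativeAt-SQN t , TPEquiv[]⇒TPEquiv (representativeAt-level t)

      representatives-unique : Recurrent c → Unique representatives
      representatives-unique c-rec = UniqueP.map⁺ representativeAt-injective (UniqueP.allFin⁺ (suc n))
        where
        c-nfs : NoForbiddenSubconfig c
        c-nfs = recurrent⇒noForbiddenSubconfig c-rec
        representativeAt-injective : ∀ {s t} → representativeAt s ≡ representativeAt t → s ≡ t
        representativeAt-injective {s} {t} eq =
          FinP.toℕ-injective (residues-equal (FinP.toℕ<n s) (FinP.toℕ<n t) (level-divisible (proj₁ c-rec) (proj₁ c-rec) c-nfs c-nfs
            (TPEquiv[]-trans (representativeAt-level s) (TPEquiv[]-sym (subst (TPEquiv[ + toℕ t ] c) (sym eq) (representativeAt-level t))))))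

      c∈representatives : Sorted c → Stable c → c ∈ representatives
      c∈representatives c↘ c-stable = SQN-TPEquiv[]⇒∈ (sorted-stable⇒SQN c↘ c-stable) (TPEquiv[]-refl c)

      ∈-representatives-recurrent⇒≡ : Sorted c → Recurrent c → ∀ u → u ∈ representatives → Recurrent u → u ≡ c
      ∈-representatives-recurrent⇒≡ c↘ c-rec u u∈ u-rec with ∈-map⁻ representativeAt u∈
      ... | t , _ , refl =
        sym (SQN-same-level⇒≡ (sorted-stable⇒SQN c↘ (proj₁ c-rec)) (representativeAt-SQN t) (TPEquiv[]-refl c) level0)
        where
        divisible : ∃[ q ] + toℕ t ≡ q * + suc n
        divisible = level-divisible (proj₁ c-rec) (proj₁ u-rec)
                      (recurrent⇒noForbiddenSubconfig c-rec) (recurrent⇒noForbiddenSubconfig u-rec) (representativeAt-level t)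
        q : ℤ
        q = proj₁ divisible
        t-qN≡0 : + toℕ t - q * + suc n ≡ 0ℤ
        t-qN≡0 = trans (cong (_- q * + suc n) (proj₂ divisible)) (ℤP.+-inverseʳ (q * + suc n))
        level0 : TPEquiv[ 0ℤ ] c (representativeAt t)
        level0 = subst (λ R → TPEquiv[ R ] c (representativeAt t)) t-qN≡0 (TPEquiv[]-shift q (representativeAt-level t))

open SQNEnumeration using (sqnConfigs; sqnConfigs-unique; length-sqnConfigs; ∈-sqnConfigs⇔SQN)
open EquivalenceClasses using (representatives; representatives-unique; length-representatives; ∈-representatives⇔; c∈representatives; ∈-representatives-recurrent⇒≡)
open import Defs
open import Data.Nat using (ℕ; suc; _+_; _*_; _≤_)
open import Data.Nat.Combinatorics using (_C_)
open import Data.List using (List; length)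
open import Data.List.Membership.Propositional using (_∈_)
open import Data.List.Relation.Unary.Unique.Propositional using (Unique)
open import Data.Product using (_×_; ∃-syntax; _,_; proj₁)
open import Function.Bundles using (_⇔_)
open import Relation.Binary.PropositionalEquality using (_≡_)

theorem5p1 : (n d : ℕ) → 1 ≤ n →
    (∃[ L ] (Unique L × length L ≡ ((2 * n + d) C n) * ((n + d) C n)
             × (∀ (u : Config n d) → (u ∈ L) ⇔ SQN u)))
    × ((c : Config n d) → Sorted c → Recurrent c →
        ∃[ L ] (Unique L × length L ≡ suc n
                × (∀ (u : Config n d) → (u ∈ L) ⇔ (SQN u × TPEquiv c u))
                × c ∈ L
                × (∀ u → u ∈ L → Sorted u → Recurrent u → u ≡ c)))
theorem5p1 n d _ =
  (sqnConfigs n d , sqnConfigs-unique n d , length-sqnConfigs n d , ∈-sqnConfigs⇔SQN n d) ,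
  λ c c↘ c-rec →
    representatives c , representatives-unique c c-rec , length-representatives c , ∈-representatives⇔ c ,
    c∈representatives c c↘ (proj₁ c-rec) , λ u u∈ _ u-rec → ∈-representatives-recurrent⇒≡ c c↘ c-rec u u∈ u-rec
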